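{- Let $G$ be a 3-edge-connected cubic non-bipartite graph. If $G$ has two edges $e$ and $f$ such that $G-\{e,f\}$ is bipartite, then $G-\{e,f\}$ is matching covered; consequently $G$ is near-bipartite.
   Context: All graphs are finite, simple and undirected. A connected graph is matching covered if every edge lies in some perfect matching. A non-bipartite matching covered graph $G$ is near-bipartite if it has two edges $e,f$ such that $G-\{e,f\}$ is bipartite and matching covered. -}

module Defs where

open import Data.Nat using (ℕ; _<_)
open import Data.Bool using (Bool; true; false; _∧_; not; if_then_else_)
open import Data.Fin using (Fin; _≟_)
open import Data.List using (List; []; _∷_; length; map; allFin)
open import Data.Bool.ListAction using (any)
open import Data.Nat.ListAction using (sum)
open import Data.Product using (Σ; ∃; _×_; _,_; proj₁; proj₂)
open import Data.Sum using (_⊎_)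
open import Relation.Nullary using (¬_; ⌊_⌋)
open import Relation.Binary.PropositionalEquality using (_≡_; _≢_)

Graph : ℕ → Set
Graph n = Fin n → Fin n → Bool

IsSimple : ∀ {n} → Graph n → Set
IsSimple G = (∀ u v → G u v ≡ G v u) × (∀ v → G v v ≡ false)

VPair : ℕ → Set
VPair n = Fin n × Fin n

IsEdge : ∀ {n} → Graph n → VPair n → Set
IsEdge G (u , v) = G u v ≡ true

SameEdge : ∀ {n} → VPair n → VPair n → Set
SameEdge (a , b) (c , d) = (a ≡ c × b ≡ d) ⊎ (a ≡ d × b ≡ c)

hits : ∀ {n} → Fin n → Fin n → VPair n → Bool
hits u v (a , b) = (⌊ u ≟ a ⌋ ∧ ⌊ v ≟ b ⌋) Data.Bool.∨ (⌊ u ≟ b ⌋ ∧ ⌊ v ≟ a ⌋)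

_∖_ : ∀ {n} → Graph n → List (VPair n) → Graph n
(G ∖ F) u v = G u v ∧ not (any (hits u v) F)

degree : ∀ {n} → Graph n → Fin n → ℕ
degree {n} G v = sum (map (λ w → if G v w then 1 else 0) (allFin n))

Cubic : ∀ {n} → Graph n → Set
Cubic G = ∀ v → degree G v ≡ 3

data Walk {n} (G : Graph n) : Fin n → Fin n → Set where
  here : ∀ {u} → Walk G u u
  step : ∀ {u v w} → G u v ≡ true → Walk G v w → Walk G u w

Connected : ∀ {n} → Graph n → Set
Connected G = ∀ u v → Walk G u v

EdgeConnected : ∀ {n} → ℕ → Graph n → Set
EdgeConnected k G = ∀ (F : List (VPair _)) → length F < k → Connected (G ∖ F)

Bipartite : ∀ {n} → Graph n → Set
Bipartite G = Σ (Fin _ → Bool) λ c → ∀ u v → G u v ≡ true → c u ≢ c v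

PerfectMatching : ∀ {n} → Graph n → Graph n → Set
PerfectMatching G M =
  (∀ u v → M u v ≡ true → G u v ≡ true) ×
  (∀ u v → M u v ≡ M v u) ×
  (∀ v → Σ (Fin _) λ w → M v w ≡ true × (∀ w' → M v w' ≡ true → w' ≡ w))

MatchingCovered : ∀ {n} → Graph n → Set
MatchingCovered G =
  Connected G ×
  (∀ u v → G u v ≡ true → Σ (Graph _) λ M → PerfectMatching G M × M u v ≡ true)

NearBipartite : ∀ {n} → Graph n → Set
NearBipartite G =
  ¬ Bipartite G × MatchingCovered G ×
  Σ (VPair _) λ e → Σ (VPair _) λ f →
    IsEdge G e × IsEdge G f × ¬ SameEdge e f ×
    Bipartite (G ∖ (e ∷ f ∷ [])) × MatchingCovered (G ∖ (e ∷ f ∷ []))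

{-# OPTIONS --safe #-}
-- Let c be a proper 2-colouring of H = G − {e, f}. Counting degrees in each colour class X gives
-- 3|X| = D + (number of ends of e and f in X), where D, the number of edges of H, is the same for both
-- classes; as the ends total 4 this forces exactly two ends in each class, and since G is not bipartite
-- e lies inside one class A and f inside the other, so |A| = |∁A|. For X ⊆ A, comparing degree sums of
-- X and of its neighbourhood N(X) with the (at least three) edges of G leaving X ∪ N(X) gives |N(X)| > |X|,
-- and |N(X)| ≥ |X| + (ends of f in N(X)) when X avoids the ends of e. Hall's theorem then matches A − K
-- with ∁A − K, where K consists of the two ends of an edge of H, or of the four ends of e and f; adding
-- that edge, or e and f, gives the perfect matchings needed for H and for G.

module Submission where

open import Defs
open import Data.Bool using (Bool; true; false; _∧_; _∨_; not; if_then_else_)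
open import Data.Bool.ListAction using (any)
open import Data.Bool.Properties
  using (∧-comm; ∧-identityʳ; ∧-zeroʳ; ∧-inverseʳ; ∧-conicalˡ; ∧-conicalʳ; ∨-comm; ∨-assoc; ∨-identityʳ; ∨-zeroʳ;
         ∨-conicalˡ; ∨-conicalʳ; not-involutive; not-injective; ¬-not)
  renaming (_≟_ to _≟ᵇ_)
open import Data.Empty using (⊥-elim)
open import Data.Fin using (Fin; zero; suc; _≟_)
open import Data.Fin.Properties using (all?)
open import Data.Fin.Subset.Properties using (anySubset?)
open import Data.List using (List; []; _∷_; _++_; length; tabulate)
open import Data.List.Properties using (length-++; map-tabulate)
open import Data.Nat using (ℕ; zero; suc; _+_; _*_; _≤_; _<_; z≤n; s≤s; s≤s⁻¹; _≤?_; _<?_)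
open import Data.Nat.Divisibility using (_∣_; divides; _∣?_; ∣m+n∣m⇒∣n)
open import Data.Nat.Induction using (<-wellFounded)
import Data.Nat.ListAction
open import Data.Nat.Properties hiding (_≟_)
open import Data.Nat.Solver using (module +-*-Solver)
open import Data.Product using (Σ; ∃; _×_; _,_; proj₁; proj₂)
open import Data.Sum using (_⊎_; inj₁; inj₂; [_,_]′)
import Data.Vec as Vec
open import Data.Vec.Properties using (lookup∘tabulate)
open import Function using (_∘_; id)
open import Induction.WellFounded using (Acc; acc)
open import Relation.Binary.PropositionalEquality
open import Relation.Nullary using (¬_; Dec; yes; no; ⌊_⌋)
open import Relation.Nullary.Decidable using (_×-dec_; _→-dec_; from-no)

open import Algebra.Properties.CommutativeSemigroup +-commutativeSemigroup
  using () renaming (interchange to +-interchange; xy∙z≈xz∙y to +-right-swap)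
open import Algebra.Properties.Semiring.Sum +-*-semiring
  using (sum; sum-syntax; ∑-distrib-+; ∑-comm; sum-cong-≗; sum-replicate-zero; *-distribˡ-sum; *-distribʳ-sum)

-- Finite sets and counting

⟦_⟧ : Bool → ℕ
⟦ b ⟧ = if b then 1 else 0

Subset : ℕ → Set
Subset n = Fin n → Bool

module _ {n : ℕ} where

  infix 4 _∈_ _∉_ _⊆_
  infixr 7 _∩_
  infixr 6 _∪_ _─_

  _∈_ _∉_ : Fin n → Subset n → Set
  x ∈ X = X x ≡ true
  x ∉ X = X x ≡ false

  _⊆_ : Subset n → Subset n → Set
  X ⊆ Y = ∀ x → x ∈ X → x ∈ Y

  _∩_ _∪_ _─_ : Subset n → Subset n → Subset n
  (X ∩ Y) x = X x ∧ Y x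
  (X ∪ Y) x = X x ∨ Y x
  (X ─ Y) x = X x ∧ not (Y x)

  ∁ : Subset n → Subset n
  ∁ X x = not (X x)

  full : Subset n
  full _ = true

  ⁅_⁆ : Fin n → Subset n
  ⁅ a ⁆ x = ⌊ x ≟ a ⌋

  card : Subset n → ℕ
  card X = sum (⟦_⟧ ∘ X)

false≢true : false ≢ true
false≢true ()

∨-true : ∀ {a b} → a ∨ b ≡ true → a ≡ true ⊎ b ≡ true
∨-true {true} _ = inj₁ refl
∨-true {false} b = inj₂ b

∨-introˡ : ∀ {a} b → a ≡ true → a ∨ b ≡ true
∨-introˡ b refl = refl

∨-introʳ : ∀ a {b} → b ≡ true → a ∨ b ≡ true
∨-introʳ true _ = refl
∨-introʳ false b = b

∧-intro : ∀ {a b} → a ≡ true → b ≡ true → a ∧ b ≡ true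
∧-intro refl refl = refl

⟦∧⟧ : ∀ a b → ⟦ a ∧ b ⟧ ≡ ⟦ a ⟧ * ⟦ b ⟧
⟦∧⟧ false b = refl
⟦∧⟧ true b = sym (+-identityʳ ⟦ b ⟧)

⟦∨⟧ : ∀ a b → (a ≡ true → b ≡ false) → ⟦ a ∨ b ⟧ ≡ ⟦ a ⟧ + ⟦ b ⟧
⟦∨⟧ false b _ = refl
⟦∨⟧ true b a⇒¬b rewrite a⇒¬b refl = refl

⟦⟧≤1 : ∀ b → ⟦ b ⟧ ≤ 1
⟦⟧≤1 false = z≤n
⟦⟧≤1 true = ≤-refl

module _ {n : ℕ} where

  ∈⁅⁆⇒≡ : ∀ {x a : Fin n} → x ∈ ⁅ a ⁆ → x ≡ a
  ∈⁅⁆⇒≡ {x} {a} x∈a with x ≟ a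
  ... | yes x≡a = x≡a

  a∈⁅a⁆ : ∀ (a : Fin n) → a ∈ ⁅ a ⁆
  a∈⁅a⁆ a with a ≟ a
  ... | yes _ = refl
  ... | no a≢a = ⊥-elim (a≢a refl)

  ≢⇒∉⁅⁆ : ∀ {x a : Fin n} → x ≢ a → x ∉ ⁅ a ⁆
  ≢⇒∉⁅⁆ {x} {a} x≢a with x ≟ a
  ... | yes x≡a = ⊥-elim (x≢a x≡a)
  ... | no _ = refl

⁅⁆⊆ : ∀ {n} {S : Subset n} {a} → a ∈ S → ⁅ a ⁆ ⊆ S
⁅⁆⊆ {S = S} a∈S x x∈a = subst (_∈ S) (sym (∈⁅⁆⇒≡ x∈a)) a∈S

⁅suc⁆ : ∀ {n} (x a : Fin n) → ⁅ suc a ⁆ (suc x) ≡ ⁅ a ⁆ x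
⁅suc⁆ x a with x ≟ a
... | yes _ = refl
... | no _ = refl

module _ {n : ℕ} (X Y : Subset n) {x : Fin n} where

  ∈─⁺ : x ∈ X → x ∉ Y → x ∈ X ─ Y
  ∈─⁺ x∈X x∉Y rewrite x∈X | x∉Y = refl

  ∈─⁻ : x ∈ X ─ Y → x ∈ X × x ∉ Y
  ∈─⁻ x∈ with X x | Y x
  ... | true | false = refl , refl

∃ᵇ : ∀ {m} → (Fin m → Bool) → Bool
∃ᵇ {zero} P = false
∃ᵇ {suc m} P = P zero ∨ ∃ᵇ (P ∘ suc)

∃ᵇ-intro : ∀ {m} (P : Fin m → Bool) x → P x ≡ true → ∃ᵇ P ≡ true
∃ᵇ-intro P zero Px = ∨-introˡ _ Px
∃ᵇ-intro P (suc x) Px = ∨-introʳ (P zero) (∃ᵇ-intro (P ∘ suc) x Px)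

∃ᵇ-cong : ∀ {m} {P Q : Fin m → Bool} → (∀ x → P x ≡ Q x) → ∃ᵇ P ≡ ∃ᵇ Q
∃ᵇ-cong {zero} P≗Q = refl
∃ᵇ-cong {suc m} P≗Q = cong₂ _∨_ (P≗Q zero) (∃ᵇ-cong (P≗Q ∘ suc))

∃ᵇ-elim : ∀ {m} (P : Fin m → Bool) → ∃ᵇ P ≡ true → ∃ λ x → P x ≡ true
∃ᵇ-elim {suc m} P ∃P with ∨-true {P zero} ∃P
... | inj₁ P0 = zero , P0
... | inj₂ ∃P′ = let x , Px = ∃ᵇ-elim (P ∘ suc) ∃P′ in suc x , Px

sum-mono-≤ : ∀ {n} {f g : Fin n → ℕ} → (∀ x → f x ≤ g x) → sum f ≤ sum g
sum-mono-≤ {zero} f≤g = z≤n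
sum-mono-≤ {suc n} f≤g = +-mono-≤ (f≤g zero) (sum-mono-≤ (f≤g ∘ suc))

sum-zero : ∀ {n} {f : Fin n → ℕ} → (∀ x → f x ≡ 0) → sum f ≡ 0
sum-zero {n} f≡0 = trans (sum-cong-≗ f≡0) (sum-replicate-zero n)

sum-⁅⁆ : ∀ {n} (a : Fin n) (f : Fin n → ℕ) → sum (λ x → ⟦ ⁅ a ⁆ x ⟧ * f x) ≡ f a
sum-⁅⁆ {suc n} zero f = begin
  (f zero + 0) + sum (λ x → ⟦ ⁅ zero ⁆ (suc x) ⟧ * f (suc x)) ≡⟨ cong₂ _+_ (+-identityʳ _) (sum-zero {n} (λ _ → refl)) ⟩
  f zero + 0                                                 ≡⟨ +-identityʳ _ ⟩
  f zero                                                     ∎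
  where open ≡-Reasoning
sum-⁅⁆ {suc n} (suc a) f = begin
  sum (λ x → ⟦ ⁅ suc a ⁆ (suc x) ⟧ * f (suc x)) ≡⟨ sum-cong-≗ (λ x → cong (λ b → ⟦ b ⟧ * f (suc x)) (⁅suc⁆ x a)) ⟩
  sum (λ x → ⟦ ⁅ a ⁆ x ⟧ * f (suc x))           ≡⟨ sum-⁅⁆ a (f ∘ suc) ⟩
  f (suc a)                                     ∎
  where open ≡-Reasoning

module _ {n : ℕ} where

  card-cong : ∀ {X Y : Subset n} → (∀ x → X x ≡ Y x) → card X ≡ card Y
  card-cong X≗Y = sum-cong-≗ (cong ⟦_⟧ ∘ X≗Y)

  card-mono : ∀ {X Y : Subset n} → X ⊆ Y → card X ≤ card Y
  card-mono {X} {Y} X⊆Y = sum-mono-≤ ⟦⟧-mono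
    where
    ⟦⟧-mono : ∀ x → ⟦ X x ⟧ ≤ ⟦ Y x ⟧
    ⟦⟧-mono x with X x in Xx
    ... | false = z≤n
    ... | true rewrite X⊆Y x Xx = ≤-refl

  card-split : ∀ (X Y : Subset n) → card X ≡ card (X ∩ Y) + card (X ─ Y)
  card-split X Y = trans (sum-cong-≗ split) (∑-distrib-+ {n} _ _)
    where
    split : ∀ x → ⟦ X x ⟧ ≡ ⟦ X x ∧ Y x ⟧ + ⟦ X x ∧ not (Y x) ⟧
    split x with X x | Y x
    ... | false | _ = refl
    ... | true | true = refl
    ... | true | false = refl

  card-∩⁅⁆ : ∀ (X : Subset n) a → card (X ∩ ⁅ a ⁆) ≡ ⟦ X a ⟧
  card-∩⁅⁆ X a = trans (sum-cong-≗ λ x → trans (⟦∧⟧ (X x) _) (*-comm ⟦ X x ⟧ _)) (sum-⁅⁆ a (⟦_⟧ ∘ X))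

  card-∩∪ : ∀ (X Y Z : Subset n) → (∀ x → x ∈ Y → x ∉ Z) → card (X ∩ (Y ∪ Z)) ≡ card (X ∩ Y) + card (X ∩ Z)
  card-∩∪ X Y Z disj = trans (sum-cong-≗ split) (∑-distrib-+ {n} _ _)
    where
    split : ∀ x → ⟦ X x ∧ (Y x ∨ Z x) ⟧ ≡ ⟦ X x ∧ Y x ⟧ + ⟦ X x ∧ Z x ⟧
    split x with X x | Y x in Yx
    ... | false | _ = refl
    ... | true | false = refl
    ... | true | true rewrite disj x Yx = refl

  card-∩⁅⁆∪⁅⁆ : ∀ (X : Subset n) {a b} → a ≢ b → card (X ∩ (⁅ a ⁆ ∪ ⁅ b ⁆)) ≡ ⟦ X a ⟧ + ⟦ X b ⟧
  card-∩⁅⁆∪⁅⁆ X {a} {b} a≢b = trans (card-∩∪ X ⁅ a ⁆ ⁅ b ⁆ disjoint) (cong₂ _+_ (card-∩⁅⁆ X a) (card-∩⁅⁆ X b))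
    where
    disjoint : ∀ x → x ∈ ⁅ a ⁆ → x ∉ ⁅ b ⁆
    disjoint x x∈a = ≢⇒∉⁅⁆ (λ x≡b → a≢b (trans (sym (∈⁅⁆⇒≡ x∈a)) x≡b))

  card-⁅⁆ : ∀ (a : Fin n) → card ⁅ a ⁆ ≡ 1
  card-⁅⁆ a = trans (sum-cong-≗ {n} λ x → sym (*-identityʳ _)) (sum-⁅⁆ a (λ _ → 1))

  card≡0⇒∉ : ∀ {X : Subset n} → card X ≡ 0 → ∀ x → x ∉ X
  card≡0⇒∉ {X} card≡0 x with X x in Xx
  ... | false = refl
  ... | true = ⊥-elim (<⇒≢ (≤-trans (≤-reflexive (sym (cong ⟦_⟧ Xx))) (point≤sum x)) (sym card≡0))
    where
    point≤sum : ∀ {m} {f : Fin m → ℕ} (y : Fin m) → f y ≤ sum f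
    point≤sum zero = m≤m+n _ _
    point≤sum (suc y) = ≤-trans (point≤sum y) (m≤n+m _ _)

card>0⇒∃∈ : ∀ {n} {X : Subset n} → 0 < card X → ∃ λ x → x ∈ X
card>0⇒∃∈ {suc n} {X} 0<card with X zero in X0
... | true = zero , X0
... | false = let x , x∈X = card>0⇒∃∈ {X = X ∘ suc} 0<card in suc x , x∈X

card-⊆-split : ∀ {n} {X S : Subset n} → X ⊆ S → card S ≡ card X + card (S ─ X)
card-⊆-split {X = X} {S} X⊆S = trans (card-split S X) (cong (_+ card (S ─ X)) (card-cong X∩S))
  where
  X∩S : ∀ x → S x ∧ X x ≡ X x
  X∩S x with X x in Xx
  ... | false = ∧-zeroʳ (S x)
  ... | true rewrite X⊆S x Xx = refl

card-⊆-⁅⁆ : ∀ {n} {S : Subset n} {a} → a ∈ S → card S ≡ 1 + card (S ─ ⁅ a ⁆)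
card-⊆-⁅⁆ {S = S} {a} a∈S = trans (card-⊆-split {X = ⁅ a ⁆} {S = S} (⁅⁆⊆ a∈S)) (cong (_+ card (S ─ ⁅ a ⁆)) (card-⁅⁆ a))

sum-tabulate : ∀ {n} (f : Fin n → ℕ) → Data.Nat.ListAction.sum (tabulate f) ≡ sum f
sum-tabulate {zero} f = refl
sum-tabulate {suc n} f = cong (f zero +_) (sum-tabulate (f ∘ suc))

degree-sum : ∀ {n} (Γ : Graph n) v → degree Γ v ≡ sum (λ w → ⟦ Γ v w ⟧)
degree-sum {n} Γ v = trans (cong Data.Nat.ListAction.sum (map-tabulate {n = n} id (λ w → ⟦ Γ v w ⟧))) (sum-tabulate {n} _)

-- Arcs between vertex sets

module _ {n : ℕ} where

  infixr 6 _∪ᴳ_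

  _∪ᴳ_ : Graph n → Graph n → Graph n
  (Γ ∪ᴳ Δ) x y = Γ x y ∨ Δ x y

  arc edge : Fin n → Fin n → Graph n
  arc a b x y = ⁅ a ⁆ x ∧ ⁅ b ⁆ y
  edge a b x y = hits x y (a , b)

  Symmetric : Graph n → Set
  Symmetric Γ = ∀ x y → Γ x y ≡ Γ y x

  arcs : Graph n → Subset n → Subset n → ℕ
  arcs Γ X Y = ∑[ x < n ] ∑[ y < n ] ⟦ (X x ∧ Y y) ∧ Γ x y ⟧

  sum₂-cong : ∀ {f g : Fin n → Fin n → ℕ} → (∀ x y → f x y ≡ g x y) →
              sum (λ x → sum (f x)) ≡ sum (λ x → sum (g x))
  sum₂-cong f≗g = sum-cong-≗ λ x → sum-cong-≗ (f≗g x)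

  arcs-mono : ∀ {Γ Δ : Graph n} {X Y X′ Y′ : Subset n} →
              (∀ x y → (X x ∧ Y y) ∧ Γ x y ≡ true → (X′ x ∧ Y′ y) ∧ Δ x y ≡ true) → arcs Γ X Y ≤ arcs Δ X′ Y′
  arcs-mono pointwise = sum-mono-≤ λ x → sum-mono-≤ λ y → ⟦⟧-mono (pointwise x y)
    where
    ⟦⟧-mono : ∀ {a b} → (a ≡ true → b ≡ true) → ⟦ a ⟧ ≤ ⟦ b ⟧
    ⟦⟧-mono {false} _ = z≤n
    ⟦⟧-mono {true} a⇒b rewrite a⇒b refl = ≤-refl

  arcs-sym : ∀ {Γ} → Symmetric Γ → ∀ X Y → arcs Γ X Y ≡ arcs Γ Y X
  arcs-sym {Γ} Γ-sym X Y = trans (∑-comm {n} {n} _) (sum₂-cong λ y x →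
    cong ⟦_⟧ (cong₂ _∧_ (∧-comm (X x) (Y y)) (Γ-sym x y)))

  arcs-split : ∀ Γ X Y Z → arcs Γ X Y ≡ arcs Γ X (Y ∩ Z) + arcs Γ X (Y ─ Z)
  arcs-split Γ X Y Z = trans (sum-cong-≗ λ x → trans (sum-cong-≗ (split x)) (∑-distrib-+ {n} _ _)) (∑-distrib-+ {n} _ _)
    where
    split : ∀ x y → ⟦ (X x ∧ Y y) ∧ Γ x y ⟧ ≡
                    ⟦ (X x ∧ (Y y ∧ Z y)) ∧ Γ x y ⟧ + ⟦ (X x ∧ (Y y ∧ not (Z y))) ∧ Γ x y ⟧
    split x y with X x | Y y | Z y | Γ x y
    ... | false | _ | _ | _ = refl
    ... | true | false | _ | _ = refl
    ... | true | true | false | false = refl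
    ... | true | true | false | true = refl
    ... | true | true | true | false = refl
    ... | true | true | true | true = refl

  arcs-∪ᴳ : ∀ Γ Δ X Y → (∀ x y → Γ x y ≡ true → Δ x y ≡ false) → arcs (Γ ∪ᴳ Δ) X Y ≡ arcs Γ X Y + arcs Δ X Y
  arcs-∪ᴳ Γ Δ X Y disj = trans (sum-cong-≗ λ x → trans (sum-cong-≗ (split x)) (∑-distrib-+ {n} _ _)) (∑-distrib-+ {n} _ _)
    where
    split : ∀ x y → ⟦ (X x ∧ Y y) ∧ (Γ x y ∨ Δ x y) ⟧ ≡ ⟦ (X x ∧ Y y) ∧ Γ x y ⟧ + ⟦ (X x ∧ Y y) ∧ Δ x y ⟧
    split x y with X x ∧ Y y
    ... | false = refl
    ... | true = ⟦∨⟧ (Γ x y) (Δ x y) (disj x y)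

  arcs-arc : ∀ a b X Y → arcs (arc a b) X Y ≡ ⟦ X a ∧ Y b ⟧
  arcs-arc a b X Y = begin
    arcs (arc a b) X Y
      ≡⟨ sum₂-cong factor ⟩
    ∑[ x < n ] ∑[ y < n ] (⟦ ⁅ a ⁆ x ⟧ * (⟦ ⁅ b ⁆ y ⟧ * ⟦ X x ∧ Y y ⟧))
      ≡⟨ sum-cong-≗ {n} (λ x → *-distribˡ-sum {n} ⟦ ⁅ a ⁆ x ⟧ (λ y → ⟦ ⁅ b ⁆ y ⟧ * ⟦ X x ∧ Y y ⟧)) ⟨
    ∑[ x < n ] (⟦ ⁅ a ⁆ x ⟧ * ∑[ y < n ] (⟦ ⁅ b ⁆ y ⟧ * ⟦ X x ∧ Y y ⟧))
      ≡⟨ sum-cong-≗ (λ x → cong (⟦ ⁅ a ⁆ x ⟧ *_) (sum-⁅⁆ b _)) ⟩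
    ∑[ x < n ] (⟦ ⁅ a ⁆ x ⟧ * ⟦ X x ∧ Y b ⟧)
      ≡⟨ sum-⁅⁆ a _ ⟩
    ⟦ X a ∧ Y b ⟧
      ∎
    where
    open ≡-Reasoning
    factor : ∀ x y → ⟦ (X x ∧ Y y) ∧ (⁅ a ⁆ x ∧ ⁅ b ⁆ y) ⟧ ≡ ⟦ ⁅ a ⁆ x ⟧ * (⟦ ⁅ b ⁆ y ⟧ * ⟦ X x ∧ Y y ⟧)
    factor x y with X x ∧ Y y | ⁅ a ⁆ x | ⁅ b ⁆ y
    ... | false | false | _ = refl
    ... | false | true | false = refl
    ... | false | true | true = refl
    ... | true | false | _ = refl
    ... | true | true | false = refl
    ... | true | true | true = refl

  arcs-edge : ∀ {a b} → a ≢ b → ∀ X Y → arcs (edge a b) X Y ≡ ⟦ X a ∧ Y b ⟧ + ⟦ X b ∧ Y a ⟧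
  arcs-edge {a} {b} a≢b X Y = trans (arcs-∪ᴳ (arc a b) (arc b a) X Y disj) (cong₂ _+_ (arcs-arc a b X Y) (arcs-arc b a X Y))
    where
    disj : ∀ x y → arc a b x y ≡ true → arc b a x y ≡ false
    disj x y ab with ⁅ b ⁆ x in x∈b
    ... | false = refl
    ... | true = ⊥-elim (a≢b (trans (sym (∈⁅⁆⇒≡ (∧-conicalˡ _ _ ab))) (∈⁅⁆⇒≡ x∈b)))

  arcs-full : ∀ {Γ} → Cubic Γ → ∀ X → arcs Γ X full ≡ card X * 3
  arcs-full {Γ} cubic X = begin
    arcs Γ X full
      ≡⟨ sum₂-cong (λ x y → ⟦∧⟧ (X x ∧ true) (Γ x y)) ⟩
    ∑[ x < n ] ∑[ y < n ] (⟦ X x ∧ true ⟧ * ⟦ Γ x y ⟧)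
      ≡⟨ sum-cong-≗ {n} (λ x → *-distribˡ-sum {n} ⟦ X x ∧ true ⟧ (λ y → ⟦ Γ x y ⟧)) ⟨
    ∑[ x < n ] (⟦ X x ∧ true ⟧ * ∑[ y < n ] ⟦ Γ x y ⟧)
      ≡⟨ sum-cong-≗ (λ x → cong₂ _*_ (cong ⟦_⟧ (∧-identityʳ (X x))) (degree≡3 x)) ⟩
    ∑[ x < n ] (⟦ X x ⟧ * 3)
      ≡⟨ *-distribʳ-sum {n} 3 (⟦_⟧ ∘ X) ⟨
    card X * 3
      ∎
    where
    open ≡-Reasoning
    degree≡3 : ∀ x → ∑[ y < n ] ⟦ Γ x y ⟧ ≡ 3
    degree≡3 x = trans (sym (degree-sum Γ x)) (cubic x)

  arcs-full-⊆ : ∀ {Γ X Y} → (∀ x y → x ∈ X → Γ x y ≡ true → y ∈ Y) → arcs Γ X full ≡ arcs Γ X Y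
  arcs-full-⊆ {Γ} {X} {Y} closed = sum₂-cong pointwise
    where
    pointwise : ∀ x y → ⟦ (X x ∧ true) ∧ Γ x y ⟧ ≡ ⟦ (X x ∧ Y y) ∧ Γ x y ⟧
    pointwise x y with X x in x∈X | Γ x y in Γxy
    ... | false | _ = refl
    ... | true | false = sym (cong ⟦_⟧ (∧-zeroʳ (Y y)))
    ... | true | true rewrite closed x y x∈X Γxy = refl

  edge⁻ : ∀ {a b x y : Fin n} → edge a b x y ≡ true → (x ≡ a × y ≡ b) ⊎ (x ≡ b × y ≡ a)
  edge⁻ {a = a} {b} {x} {y} xy∈ with ∨-true {arc a b x y} xy∈
  ... | inj₁ ab = inj₁ (∈⁅⁆⇒≡ (∧-conicalˡ _ _ ab) , ∈⁅⁆⇒≡ (∧-conicalʳ (⁅ a ⁆ x) _ ab))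
  ... | inj₂ ba = inj₂ (∈⁅⁆⇒≡ (∧-conicalˡ _ _ ba) , ∈⁅⁆⇒≡ (∧-conicalʳ (⁅ b ⁆ x) _ ba))

  edge-self : ∀ (a b : Fin n) → edge a b a b ≡ true
  edge-self a b = ∨-introˡ _ (∧-intro (a∈⁅a⁆ a) (a∈⁅a⁆ b))

  edge-sym : ∀ (a b : Fin n) → Symmetric (edge a b)
  edge-sym a b x y = trans (∨-comm (arc a b x y) _) (cong₂ _∨_ (∧-comm (⁅ b ⁆ x) _) (∧-comm (⁅ a ⁆ x) _))

  edge⊆ : ∀ {Γ : Graph n} → Symmetric Γ → ∀ {a b} → Γ a b ≡ true → ∀ x y → edge a b x y ≡ true → Γ x y ≡ true
  edge⊆ Γ-sym {a} {b} Γab x y xy∈ with edge⁻ {a = a} {b} {x} {y} xy∈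
  ... | inj₁ (refl , refl) = Γab
  ... | inj₂ (refl , refl) = trans (Γ-sym x y) Γab

  edge-separated : ∀ {c : Subset n} {a b u v} → c a ≢ c b → edge a b u v ≡ true → c u ≢ c v
  edge-separated {a = a} {b} {u} {v} ca≢cb uv∈ with edge⁻ {a = a} {b} {u} {v} uv∈
  ... | inj₁ (refl , refl) = ca≢cb
  ... | inj₂ (refl , refl) = ca≢cb ∘ sym

  walk-⊆ : ∀ {Γ Δ : Graph n} → (∀ x y → Γ x y ≡ true → Δ x y ≡ true) → ∀ {u v} → Walk Γ u v → Walk Δ u v
  walk-⊆ Γ⊆Δ here = here
  walk-⊆ Γ⊆Δ (step Γuv walk) = step (Γ⊆Δ _ _ Γuv) (walk-⊆ Γ⊆Δ walk)

-- Edge cuts in k-edge-connected graphs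

module _ {A : Set} where

  select : ∀ {m} → (Fin m → Bool) → (Fin m → A) → List A
  select {zero} P f = []
  select {suc m} P f with P zero
  ... | true = f zero ∷ select (P ∘ suc) (f ∘ suc)
  ... | false = select (P ∘ suc) (f ∘ suc)

  length-select : ∀ {m} (P : Fin m → Bool) f → length (select P f) ≡ card P
  length-select {zero} P f = refl
  length-select {suc m} P f with P zero
  ... | true = cong suc (length-select (P ∘ suc) (f ∘ suc))
  ... | false = length-select (P ∘ suc) (f ∘ suc)

  any-select : ∀ {m} (P : Fin m → Bool) f (q : A → Bool) x → P x ≡ true → q (f x) ≡ true → any q (select P f) ≡ true
  any-select P f q zero Px qfx with P zero
  any-select P f q zero refl qfx | true = ∨-introˡ _ qfx
  any-select P f q (suc x) Px qfx with P zero
  ... | true = ∨-introʳ (q (f zero)) (any-select (P ∘ suc) (f ∘ suc) q x Px qfx)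
  ... | false = any-select (P ∘ suc) (f ∘ suc) q x Px qfx

  concatFin : ∀ {m} → (Fin m → List A) → List A
  concatFin {zero} L = []
  concatFin {suc m} L = L zero ++ concatFin (L ∘ suc)

  length-concatFin : ∀ {m} (L : Fin m → List A) → length (concatFin L) ≡ sum (length ∘ L)
  length-concatFin {zero} L = refl
  length-concatFin {suc m} L = trans (length-++ (L zero)) (cong (length (L zero) +_) (length-concatFin (L ∘ suc)))

  any-++ : ∀ (q : A → Bool) xs {ys} → any q (xs ++ ys) ≡ any q xs ∨ any q ys
  any-++ q [] = refl
  any-++ q (x ∷ xs) = trans (cong (q x ∨_) (any-++ q xs)) (sym (∨-assoc (q x) _ _))

  any-concatFin : ∀ {m} (L : Fin m → List A) (q : A → Bool) x → any q (L x) ≡ true → any q (concatFin L) ≡ true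
  any-concatFin L q zero qLx = trans (any-++ q (L zero)) (∨-introˡ _ qLx)
  any-concatFin L q (suc x) qLx = trans (any-++ q (L zero)) (∨-introʳ (any q (L zero)) (any-concatFin (L ∘ suc) q x qLx))

module _ {n : ℕ} where

  arcList : Graph n → Subset n → Subset n → List (VPair n)
  arcList Γ X Y = concatFin λ x → select (λ y → (X x ∧ Y y) ∧ Γ x y) (x ,_)

  length-arcList : ∀ Γ X Y → length (arcList Γ X Y) ≡ arcs Γ X Y
  length-arcList Γ X Y =
    trans (length-concatFin {m = n} _) (sum-cong-≗ {n} λ x → length-select (λ y → (X x ∧ Y y) ∧ Γ x y) (x ,_))

  arcList-complete : ∀ Γ X Y x y → (X x ∧ Y y) ∧ Γ x y ≡ true → any (hits x y) (arcList Γ X Y) ≡ true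
  arcList-complete Γ X Y x y xy∈ =
    any-concatFin _ (hits x y) x (any-select (λ y → (X x ∧ Y y) ∧ Γ x y) (x ,_) (hits x y) y xy∈ (edge-self x y))

  walk-crossing : ∀ {Γ : Graph n} (S : Subset n) {s t} → Walk Γ s t → s ∈ S → t ∉ S →
                  ∃ λ x → ∃ λ y → Γ x y ≡ true × x ∈ S × y ∉ S
  walk-crossing S here s∈S s∉S = ⊥-elim (false≢true (trans (sym s∉S) s∈S))
  walk-crossing S (step {u} {v} Γuv walk) u∈S t∉S with S v in v∈S
  ... | true = walk-crossing S walk v∈S t∉S
  ... | false = u , v , Γuv , u∈S , v∈S

  cut-bound : ∀ {k Γ} → EdgeConnected k Γ → ∀ S {s t} → s ∈ S → t ∉ S → k ≤ arcs Γ S (∁ S)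
  cut-bound {k} {Γ} connected S {s} {t} s∈S t∉S with k ≤? arcs Γ S (∁ S)
  ... | yes k≤cut = k≤cut
  ... | no k≰cut with walk-crossing S (connected cutArcs |cutArcs|<k s t) s∈S t∉S
    where
    cutArcs : List (VPair n)
    cutArcs = arcList Γ S (∁ S)
    |cutArcs|<k : length cutArcs < k
    |cutArcs|<k = subst (_< k) (sym (length-arcList Γ S (∁ S))) (≰⇒> k≰cut)
  ... | x , y , Δxy , x∈S , y∉S = ⊥-elim (false≢true (trans (sym uncut) cut))
    where
    cut : any (hits x y) (arcList Γ S (∁ S)) ≡ true
    cut = arcList-complete Γ S (∁ S) x y (∧-intro (∧-intro x∈S (cong not y∉S)) (∧-conicalˡ (Γ x y) _ Δxy))
    uncut : any (hits x y) (arcList Γ S (∁ S)) ≡ false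
    uncut = trans (sym (not-involutive _)) (cong not (∧-conicalʳ (Γ x y) _ Δxy))

-- Hall's marriage theorem

module Hall {n : ℕ} (R : Fin n → Fin n → Bool) where

  neighbours : Subset n → Subset n → Subset n
  neighbours T X y = T y ∧ ∃ᵇ (λ x → X x ∧ R x y)

  neighbours⁺ : ∀ {T X x y} → x ∈ X → R x y ≡ true → y ∈ T → y ∈ neighbours T X
  neighbours⁺ {X = X} {x} {y} x∈X Rxy y∈T = ∧-intro y∈T (∃ᵇ-intro (λ x → X x ∧ R x y) x (∧-intro x∈X Rxy))

  neighbours⁻ : ∀ {T X y} → y ∈ neighbours T X → y ∈ T × ∃ λ x → x ∈ X × R x y ≡ true
  neighbours⁻ {T} {X} {y} y∈N with ∃ᵇ-elim (λ x → X x ∧ R x y) (∧-conicalʳ (T y) _ y∈N)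
  ... | x , XRxy = ∧-conicalˡ (T y) _ y∈N , x , ∧-conicalˡ (X x) _ XRxy , ∧-conicalʳ (X x) _ XRxy

  HallCondition : Subset n → Subset n → Set
  HallCondition S T = ∀ X → X ⊆ S → card X ≤ card (neighbours T X)

  record Pairing (S : Subset n) (T : Subset n) : Set where
    field
      to : Fin n → Fin n
      from : Fin n → Fin n
      to∈ : ∀ x → x ∈ S → to x ∈ T
      adjacent : ∀ x → x ∈ S → R x (to x) ≡ true
      from-to : ∀ x → x ∈ S → from (to x) ≡ x
      from∈ : ∀ y → y ∈ T → from y ∈ S
      to-from : ∀ y → y ∈ T → to (from y) ≡ y

  pairing-∅ : ∀ {S T} → card S ≡ 0 → card T ≡ 0 → Pairing S T
  pairing-∅ {S} {T} |S|≡0 |T|≡0 = record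
    { to = id ; from = id
    ; to∈ = λ x x∈S → absurd (card≡0⇒∉ |S|≡0 x) x∈S
    ; adjacent = λ x x∈S → absurd (card≡0⇒∉ |S|≡0 x) x∈S
    ; from-to = λ x x∈S → absurd (card≡0⇒∉ |S|≡0 x) x∈S
    ; from∈ = λ y y∈T → absurd (card≡0⇒∉ |T|≡0 y) y∈T
    ; to-from = λ y y∈T → absurd (card≡0⇒∉ |T|≡0 y) y∈T
    }
    where
    absurd : ∀ {b} {A : Set} → b ≡ false → b ≡ true → A
    absurd refl ()

  pairing-⁅⁆ : ∀ {a b} → R a b ≡ true → Pairing ⁅ a ⁆ ⁅ b ⁆
  pairing-⁅⁆ {a} {b} Rab = record
    { to = λ _ → b ; from = λ _ → a
    ; to∈ = λ _ _ → a∈⁅a⁆ b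
    ; adjacent = λ x x∈a → subst (λ x → R x b ≡ true) (sym (∈⁅⁆⇒≡ x∈a)) Rab
    ; from-to = λ x x∈a → sym (∈⁅⁆⇒≡ x∈a)
    ; from∈ = λ _ _ → a∈⁅a⁆ a
    ; to-from = λ y y∈b → sym (∈⁅⁆⇒≡ y∈b)
    }

  pairing-glue : ∀ {S T X Y} → X ⊆ S → Y ⊆ T → Pairing X Y → Pairing (S ─ X) (T ─ Y) → Pairing S T
  pairing-glue {S} {T} {X} {Y} X⊆S Y⊆T inner outer = record
    { to = to ; from = from
    ; to∈ = to∈ ; adjacent = adjacent ; from-to = from-to ; from∈ = from∈ ; to-from = to-from }
    where
    module I = Pairing inner
    module O = Pairing outer

    to : Fin n → Fin n
    to x = if X x then I.to x else O.to x
    from : Fin n → Fin n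
    from y = if Y y then I.from y else O.from y

    to∈ : ∀ x → x ∈ S → to x ∈ T
    to∈ x x∈S with X x in x∈X
    ... | true = Y⊆T _ (I.to∈ x x∈X)
    ... | false = proj₁ (∈─⁻ T Y (O.to∈ x (∈─⁺ S X x∈S x∈X)))

    adjacent : ∀ x → x ∈ S → R x (to x) ≡ true
    adjacent x x∈S with X x in x∈X
    ... | true = I.adjacent x x∈X
    ... | false = O.adjacent x (∈─⁺ S X x∈S x∈X)

    from-to : ∀ x → x ∈ S → from (to x) ≡ x
    from-to x x∈S with X x in x∈X
    ... | true rewrite I.to∈ x x∈X = I.from-to x x∈X
    ... | false with ∈─⁻ T Y (O.to∈ x (∈─⁺ S X x∈S x∈X))
    ... | _ , y∉Y rewrite y∉Y = O.from-to x (∈─⁺ S X x∈S x∈X)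

    from∈ : ∀ y → y ∈ T → from y ∈ S
    from∈ y y∈T with Y y in y∈Y
    ... | true = X⊆S _ (I.from∈ y y∈Y)
    ... | false = proj₁ (∈─⁻ S X (O.from∈ y (∈─⁺ T Y y∈T y∈Y)))

    to-from : ∀ y → y ∈ T → to (from y) ≡ y
    to-from y y∈T with Y y in y∈Y
    ... | true rewrite I.from∈ y y∈Y = I.to-from y y∈Y
    ... | false with ∈─⁻ S X (O.from∈ y (∈─⁺ T Y y∈T y∈Y))
    ... | _ , x∉X rewrite x∉X = O.to-from y (∈─⁺ T Y y∈T y∈Y)

  neighbours-─ : ∀ T X U → neighbours T X ─ U ⊆ neighbours (T ─ U) X
  neighbours-─ T X U y y∈ with ∈─⁻ (neighbours T X) U y∈
  ... | y∈N , y∉U with neighbours⁻ {T} {X} y∈N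
  ... | y∈T , x , x∈X , Rxy = neighbours⁺ {T ─ U} {X} x∈X Rxy (∈─⁺ T U y∈T y∉U)

  hall-⊆ : ∀ {S T X} → HallCondition S T → X ⊆ S → HallCondition X (neighbours T X)
  hall-⊆ {S} {T} {X} hall X⊆S Z Z⊆X = ≤-trans (hall Z (λ x → X⊆S x ∘ Z⊆X x)) (card-mono N⊆N)
    where
    N⊆N : neighbours T Z ⊆ neighbours (neighbours T X) Z
    N⊆N y y∈N with neighbours⁻ {T} {Z} y∈N
    ... | y∈T , x , x∈Z , Rxy = neighbours⁺ {neighbours T X} {Z} x∈Z Rxy (neighbours⁺ {T} {X} (Z⊆X x x∈Z) Rxy y∈T)

  hall-─tight : ∀ {S T X} → HallCondition S T → X ⊆ S → card (neighbours T X) ≤ card X →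
                HallCondition (S ─ X) (T ─ neighbours T X)
  hall-─tight {S} {T} {X} hall X⊆S |N|≤|X| Z Z⊆S─X = +-cancelˡ-≤ (card X) _ _ (begin
    card X + card Z                                        ≡⟨ |W| ⟨
    card W                                                 ≤⟨ hall W W⊆S ⟩
    card (neighbours T W)                                  ≡⟨ card-split (neighbours T W) Y ⟩
    card (neighbours T W ∩ Y) + card (neighbours T W ─ Y)  ≤⟨ +-mono-≤ (card-mono ∩Y⊆Y) (card-mono ─Y⊆) ⟩
    card Y + card (neighbours (T ─ Y) Z)                   ≤⟨ +-monoˡ-≤ _ |N|≤|X| ⟩
    card X + card (neighbours (T ─ Y) Z)                   ∎)
    where
    open ≤-Reasoning
    Y W : Subset n
    Y = neighbours T X
    W = Z ∪ X

    W⊆S : W ⊆ S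
    W⊆S x x∈W with ∨-true {Z x} x∈W
    ... | inj₁ x∈Z = proj₁ (∈─⁻ S X (Z⊆S─X x x∈Z))
    ... | inj₂ x∈X = X⊆S x x∈X

    W─X≗Z : ∀ x → (W ─ X) x ≡ Z x
    W─X≗Z x with Z x in Zx
    ... | true rewrite proj₂ (∈─⁻ S X (Z⊆S─X x Zx)) = refl
    ... | false = ∧-inverseʳ (X x)

    |W| : card W ≡ card X + card Z
    |W| = trans (card-⊆-split {X = X} {S = W} (λ x → ∨-introʳ (Z x))) (cong (card X +_) (card-cong W─X≗Z))

    ∩Y⊆Y : neighbours T W ∩ Y ⊆ Y
    ∩Y⊆Y y = ∧-conicalʳ (neighbours T W y) (Y y)

    ─Y⊆ : neighbours T W ─ Y ⊆ neighbours (T ─ Y) Z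
    ─Y⊆ y y∈ with ∈─⁻ (neighbours T W) Y y∈
    ... | y∈N , y∉Y with neighbours⁻ {T} {W} y∈N
    ... | y∈T , x , x∈W , Rxy with ∨-true {Z x} x∈W
    ... | inj₁ x∈Z = neighbours⁺ {T ─ Y} {Z} x∈Z Rxy (∈─⁺ T Y y∈T y∉Y)
    ... | inj₂ x∈X with () ← trans (sym y∉Y) (neighbours⁺ {T} {X} x∈X Rxy y∈T)

  Tight : Subset n → Subset n → Subset n → Set
  Tight S T X = X ⊆ S × 0 < card X × card X < card S × card (neighbours T X) ≤ card X

  tight? : ∀ S T X → Dec (Tight S T X)
  tight? S T X = all? (λ x → (X x ≟ᵇ true) →-dec (S x ≟ᵇ true))
           ×-dec 0 <? card X ×-dec card X <? card S ×-dec card (neighbours T X) ≤? card X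

  Tight-resp : ∀ {S T X X′} → (∀ x → X x ≡ X′ x) → Tight S T X → Tight S T X′
  Tight-resp {S} {T} {X} {X′} X≗X′ (X⊆S , 0<|X| , |X|<|S| , |N|≤|X|) =
    (λ x x∈X′ → X⊆S x (trans (X≗X′ x) x∈X′)) ,
    subst (0 <_) |X|≡ 0<|X| , subst (_< card S) |X|≡ |X|<|S| ,
    subst₂ _≤_ (card-cong N≗N) |X|≡ |N|≤|X|
    where
    |X|≡ : card X ≡ card X′
    |X|≡ = card-cong X≗X′
    N≗N : ∀ y → neighbours T X y ≡ neighbours T X′ y
    N≗N y = cong (T y ∧_) (∃ᵇ-cong λ x → cong (_∧ R x y) (X≗X′ x))

  hall-─⁅⁆ : ∀ {S T a b} → HallCondition S T → (∀ Z → ¬ Tight S T Z) → a ∈ S →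
             HallCondition (S ─ ⁅ a ⁆) (T ─ ⁅ b ⁆)
  hall-─⁅⁆ {S} {T} {a} {b} hall no-tight a∈S Z Z⊆ with 0 <? card Z
  ... | no |Z|≯0 = ≤-trans (≮⇒≥ |Z|≯0) z≤n
  ... | yes 0<|Z| = s≤s⁻¹ (begin-strict
    card Z                                                   <⟨ ≰⇒> (λ |N|≤|Z| → no-tight Z (Z⊆S , 0<|Z| , |Z|<|S| , |N|≤|Z|)) ⟩
    card (neighbours T Z)                                    ≡⟨ card-split (neighbours T Z) ⁅ b ⁆ ⟩
    card (neighbours T Z ∩ ⁅ b ⁆) + card (neighbours T Z ─ ⁅ b ⁆) ≤⟨ +-mono-≤ ∩⁅b⁆≤1 (card-mono (neighbours-─ T Z ⁅ b ⁆)) ⟩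
    1 + card (neighbours (T ─ ⁅ b ⁆) Z)                      ∎)
    where
    open ≤-Reasoning
    Z⊆S : Z ⊆ S
    Z⊆S x = proj₁ ∘ ∈─⁻ S ⁅ a ⁆ ∘ Z⊆ x
    |Z|<|S| : card Z < card S
    |Z|<|S| = begin-strict
      card Z               ≤⟨ card-mono Z⊆ ⟩
      card (S ─ ⁅ a ⁆)     <⟨ ≤-refl ⟩
      1 + card (S ─ ⁅ a ⁆) ≡⟨ card-⊆-⁅⁆ {S = S} a∈S ⟨
      card S               ∎
    ∩⁅b⁆≤1 : card (neighbours T Z ∩ ⁅ b ⁆) ≤ 1
    ∩⁅b⁆≤1 = ≤-trans (card-mono (λ y → ∧-conicalʳ (neighbours T Z y) _)) (≤-reflexive (card-⁅⁆ b))

  tight-sizes : ∀ {S T X} → card S ≡ card T → HallCondition S T → Tight S T X →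
                card X ≡ card (neighbours T X) × card (S ─ X) < card S × card (S ─ X) ≡ card (T ─ neighbours T X)
  tight-sizes {S} {T} {X} |S|≡|T| hall (X⊆S , 0<|X| , _ , |N|≤|X|) = |X|≡|Y| , |S─X|<|S| , |S─X|≡|T─Y|
    where
    Y : Subset n
    Y = neighbours T X
    |X|≡|Y| : card X ≡ card Y
    |X|≡|Y| = ≤-antisym (hall X X⊆S) |N|≤|X|
    |S|≡ : card S ≡ card X + card (S ─ X)
    |S|≡ = card-⊆-split X⊆S
    |S─X|<|S| : card (S ─ X) < card S
    |S─X|<|S| = subst (card (S ─ X) <_) (sym |S|≡) (m<n+m _ 0<|X|)
    |S─X|≡|T─Y| : card (S ─ X) ≡ card (T ─ Y)
    |S─X|≡|T─Y| = +-cancelˡ-≡ (card X) _ _ (begin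
      card X + card (S ─ X) ≡⟨ |S|≡ ⟨
      card S                ≡⟨ |S|≡|T| ⟩
      card T                ≡⟨ card-⊆-split {X = Y} {S = T} (λ y → proj₁ ∘ neighbours⁻ {T} {X}) ⟩
      card Y + card (T ─ Y) ≡⟨ cong (_+ card (T ─ Y)) |X|≡|Y| ⟨
      card X + card (T ─ Y) ∎)
      where open ≡-Reasoning

  hall-neighbour : ∀ {S T a} → HallCondition S T → a ∈ S → ∃ λ b → b ∈ T × R a b ≡ true
  hall-neighbour {S} {T} {a} hall a∈S with card>0⇒∃∈ {X = neighbours T ⁅ a ⁆} 0<|N|
    where
    0<|N| : 0 < card (neighbours T ⁅ a ⁆)
    0<|N| = ≤-trans (≤-reflexive (sym (card-⁅⁆ a))) (hall ⁅ a ⁆ (⁅⁆⊆ a∈S))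
  ... | b , b∈N with neighbours⁻ {T} {⁅ a ⁆} b∈N
  ... | b∈T , x , x∈a , Rxb = b , b∈T , subst (λ x → R x b ≡ true) (∈⁅⁆⇒≡ x∈a) Rxb

  -- Halmos–Vaughan: split along a tight set if there is one, otherwise match any edge and remove it.
  marriage : ∀ S T → Acc _<_ (card S) → card S ≡ card T → HallCondition S T → Pairing S T
  marriage S T (acc smaller) |S|≡|T| hall with anySubset? (λ X → tight? S T (Vec.lookup X))
  ... | yes (X′ , tight@(X⊆S , _ , |X|<|S| , |N|≤|X|)) =
    let |X|≡|Y| , |S─X|<|S| , |S─X|≡|T─Y| = tight-sizes |S|≡|T| hall tight in
    pairing-glue X⊆S (λ y → proj₁ ∘ neighbours⁻ {T} {Vec.lookup X′})
      (marriage _ _ (smaller |X|<|S|) |X|≡|Y| (hall-⊆ hall X⊆S))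
      (marriage _ _ (smaller |S─X|<|S|) |S─X|≡|T─Y| (hall-─tight hall X⊆S |N|≤|X|))
  ... | no no-tight with 0 <? card S
  ... | no |S|≯0 = pairing-∅ |S|≡0 (trans (sym |S|≡|T|) |S|≡0)
    where
    |S|≡0 : card S ≡ 0
    |S|≡0 = n≤0⇒n≡0 (≮⇒≥ |S|≯0)
  ... | yes 0<|S| with card>0⇒∃∈ {X = S} 0<|S|
  ... | a , a∈S with hall-neighbour hall a∈S
  ... | b , b∈T , Rab =
    pairing-glue (⁅⁆⊆ a∈S) (⁅⁆⊆ b∈T) (pairing-⁅⁆ Rab)
      (marriage (S ─ ⁅ a ⁆) (T ─ ⁅ b ⁆) (smaller |S─a|<|S|) |S─a|≡|T─b| (hall-─⁅⁆ hall no-tight′ a∈S))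
    where
    |S─a|<|S| : card (S ─ ⁅ a ⁆) < card S
    |S─a|<|S| = ≤-reflexive (sym (card-⊆-⁅⁆ {S = S} a∈S))
    |S─a|≡|T─b| : card (S ─ ⁅ a ⁆) ≡ card (T ─ ⁅ b ⁆)
    |S─a|≡|T─b| = suc-injective (trans (sym (card-⊆-⁅⁆ {S = S} a∈S)) (trans |S|≡|T| (card-⊆-⁅⁆ {S = T} b∈T)))
    no-tight′ : ∀ Z → ¬ Tight S T Z
    no-tight′ Z tight = no-tight (Vec.tabulate Z , Tight-resp (λ x → sym (lookup∘tabulate Z x)) tight)

  hall : ∀ {S T} → card S ≡ card T → HallCondition S T → Pairing S T
  hall {S} {T} = marriage S T (<-wellFounded (card S))

-- Perfect matchings assembled from pieces

pairing-⊆ : ∀ {n} {R R′ : Graph n} {S T} → (∀ x y → R x y ≡ true → R′ x y ≡ true) →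
            Hall.Pairing R S T → Hall.Pairing R′ S T
pairing-⊆ R⊆R′ pairing = record
  { to = to ; from = from ; to∈ = to∈ ; adjacent = λ x x∈S → R⊆R′ x (to x) (adjacent x x∈S)
  ; from-to = from-to ; from∈ = from∈ ; to-from = to-from }
  where open Hall.Pairing pairing

module _ {n : ℕ} where

  perfectMatching-⊆ : ∀ {Γ Δ M : Graph n} → (∀ x y → Γ x y ≡ true → Δ x y ≡ true) →
                      PerfectMatching Γ M → PerfectMatching Δ M
  perfectMatching-⊆ Γ⊆Δ (M⊆Γ , M-sym , partner) = (λ x y → Γ⊆Δ x y ∘ M⊆Γ x y) , M-sym , partner

  record PerfectMatchingOn (Γ : Graph n) (K : Subset n) (P : Graph n) : Set where
    field
      ⊆Γ : ∀ x y → P x y ≡ true → Γ x y ≡ true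
      dom : ∀ x y → P x y ≡ true → x ∈ K
      symmetric : Symmetric P
      partner : ∀ v → v ∈ K → Σ (Fin n) λ w → P v w ≡ true × (∀ w′ → P v w′ ≡ true → w′ ≡ w)

  perfectMatching : ∀ {Γ K P} → (∀ v → v ∈ K) → PerfectMatchingOn Γ K P → PerfectMatching Γ P
  perfectMatching K-full M = ⊆Γ , symmetric , λ v → partner v (K-full v)
    where open PerfectMatchingOn M

  edge-perfectMatchingOn : ∀ {Γ} → Symmetric Γ → ∀ {a b} → a ≢ b → Γ a b ≡ true →
                           PerfectMatchingOn Γ (⁅ a ⁆ ∪ ⁅ b ⁆) (edge a b)
  edge-perfectMatchingOn Γ-sym {a} {b} a≢b Γab = record
    { ⊆Γ = edge⊆ Γ-sym Γab
    ; dom = dom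
    ; symmetric = edge-sym a b
    ; partner = partner
    }
    where
    dom : ∀ x y → edge a b x y ≡ true → x ∈ ⁅ a ⁆ ∪ ⁅ b ⁆
    dom x y xy∈ with edge⁻ {a = a} {b} {x} {y} xy∈
    ... | inj₁ (refl , _) = ∨-introˡ _ (a∈⁅a⁆ x)
    ... | inj₂ (refl , _) = ∨-introʳ (⁅ a ⁆ x) (a∈⁅a⁆ x)

    partner : ∀ v → v ∈ ⁅ a ⁆ ∪ ⁅ b ⁆ →
              Σ (Fin n) λ w → edge a b v w ≡ true × (∀ w′ → edge a b v w′ ≡ true → w′ ≡ w)
    partner v v∈ with ∨-true {⁅ a ⁆ v} v∈
    ... | inj₁ v∈a rewrite ∈⁅⁆⇒≡ v∈a = b , edge-self a b , unique
      where
      unique : ∀ w′ → edge a b a w′ ≡ true → w′ ≡ b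
      unique w′ aw′ with edge⁻ {a = a} {b} {a} aw′
      ... | inj₁ (_ , w′≡b) = w′≡b
      ... | inj₂ (a≡b , _) = ⊥-elim (a≢b a≡b)
    ... | inj₂ v∈b rewrite ∈⁅⁆⇒≡ v∈b = a , trans (edge-sym a b b a) (edge-self a b) , unique
      where
      unique : ∀ w′ → edge a b b w′ ≡ true → w′ ≡ a
      unique w′ bw′ with edge⁻ {a = a} {b} {b} bw′
      ... | inj₁ (b≡a , _) = ⊥-elim (a≢b (sym b≡a))
      ... | inj₂ (_ , w′≡a) = w′≡a

  ∪-perfectMatchingOn : ∀ {Γ K₁ K₂ P₁ P₂} → (∀ v → v ∈ K₁ → v ∉ K₂) →
                        PerfectMatchingOn Γ K₁ P₁ → PerfectMatchingOn Γ K₂ P₂ →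
                        PerfectMatchingOn Γ (K₁ ∪ K₂) (P₁ ∪ᴳ P₂)
  ∪-perfectMatchingOn {Γ} {K₁} {K₂} {P₁} {P₂} disjoint M₁ M₂ = record
    { ⊆Γ = λ x y xy∈ → [ M₁.⊆Γ x y , M₂.⊆Γ x y ]′ (∨-true xy∈)
    ; dom = λ x y xy∈ → [ ∨-introˡ _ ∘ M₁.dom x y , ∨-introʳ (K₁ x) ∘ M₂.dom x y ]′ (∨-true xy∈)
    ; symmetric = λ x y → cong₂ _∨_ (M₁.symmetric x y) (M₂.symmetric x y)
    ; partner = partner
    }
    where
    module M₁ = PerfectMatchingOn M₁
    module M₂ = PerfectMatchingOn M₂

    partner : ∀ v → v ∈ K₁ ∪ K₂ →
              Σ (Fin n) λ w → (P₁ ∪ᴳ P₂) v w ≡ true × (∀ w′ → (P₁ ∪ᴳ P₂) v w′ ≡ true → w′ ≡ w)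
    partner v v∈ with ∨-true {K₁ v} v∈
    ... | inj₁ v∈K₁ = let w , vw , unique = M₁.partner v v∈K₁ in w , ∨-introˡ _ vw , λ w′ vw′ →
      [ unique w′ , (λ vw′∈P₂ → ⊥-elim (false≢true (trans (sym (disjoint v v∈K₁)) (M₂.dom v w′ vw′∈P₂)))) ]′ (∨-true vw′)
    ... | inj₂ v∈K₂ = let w , vw , unique = M₂.partner v v∈K₂ in w , ∨-introʳ (P₁ v w) vw , λ w′ vw′ →
      [ (λ vw′∈P₁ → ⊥-elim (false≢true (trans (sym (disjoint v (M₁.dom v w′ vw′∈P₁))) v∈K₂))) , unique w′ ]′ (∨-true vw′)

  module _ {Γ : Graph n} (Γ-sym : Symmetric Γ) {S T : Subset n} (disjoint : ∀ v → v ∈ S → v ∉ T)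
           (pairing : Hall.Pairing Γ S T) where

    open Hall.Pairing pairing

    pairingGraph : Graph n
    pairingGraph x y = (S x ∧ ⁅ to x ⁆ y) ∨ (S y ∧ ⁅ to y ⁆ x)

    private
      pairingGraph⁻ : ∀ {x y} → pairingGraph x y ≡ true → (x ∈ S × y ≡ to x) ⊎ (y ∈ S × x ≡ to y)
      pairingGraph⁻ {x} {y} xy∈ with ∨-true {S x ∧ ⁅ to x ⁆ y} xy∈
      ... | inj₁ xy = inj₁ (∧-conicalˡ _ _ xy , ∈⁅⁆⇒≡ (∧-conicalʳ (S x) _ xy))
      ... | inj₂ yx = inj₂ (∧-conicalˡ _ _ yx , ∈⁅⁆⇒≡ (∧-conicalʳ (S y) _ yx))

      ∉S : ∀ {v} → v ∈ T → v ∉ S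
      ∉S {v} v∈T with S v in v∈S
      ... | false = refl
      ... | true = ⊥-elim (false≢true (trans (sym (disjoint v v∈S)) v∈T))

    pairing-perfectMatchingOn : PerfectMatchingOn Γ (S ∪ T) pairingGraph
    pairing-perfectMatchingOn = record
      { ⊆Γ = ⊆Γ
      ; dom = dom
      ; symmetric = λ x y → ∨-comm (S x ∧ ⁅ to x ⁆ y) _
      ; partner = partner
      }
      where
      ⊆Γ : ∀ x y → pairingGraph x y ≡ true → Γ x y ≡ true
      ⊆Γ x y xy∈ with pairingGraph⁻ xy∈
      ... | inj₁ (x∈S , refl) = adjacent x x∈S
      ... | inj₂ (y∈S , refl) = trans (Γ-sym (to y) y) (adjacent y y∈S)

      dom : ∀ x y → pairingGraph x y ≡ true → x ∈ S ∪ T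
      dom x y xy∈ with pairingGraph⁻ xy∈
      ... | inj₁ (x∈S , _) = ∨-introˡ _ x∈S
      ... | inj₂ (y∈S , refl) = ∨-introʳ (S (to y)) (to∈ y y∈S)

      partner : ∀ v → v ∈ S ∪ T →
                Σ (Fin n) λ w → pairingGraph v w ≡ true × (∀ w′ → pairingGraph v w′ ≡ true → w′ ≡ w)
      partner v v∈ with ∨-true {S v} v∈
      ... | inj₁ v∈S = to v , ∨-introˡ _ (∧-intro v∈S (a∈⁅a⁆ (to v))) , unique
        where
        unique : ∀ w′ → pairingGraph v w′ ≡ true → w′ ≡ to v
        unique w′ vw′ with pairingGraph⁻ vw′
        ... | inj₁ (_ , w′≡) = w′≡
        ... | inj₂ (w′∈S , refl) = ⊥-elim (false≢true (trans (sym (∉S (to∈ w′ w′∈S))) v∈S))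
      ... | inj₂ v∈T = from v , ∨-introʳ (S v ∧ _) (∧-intro (from∈ v v∈T) v∈⁅to-from⁆) , unique
        where
        v∈⁅to-from⁆ : v ∈ ⁅ to (from v) ⁆
        v∈⁅to-from⁆ = subst (_∈ ⁅ to (from v) ⁆) (to-from v v∈T) (a∈⁅a⁆ _)
        unique : ∀ w′ → pairingGraph v w′ ≡ true → w′ ≡ from v
        unique w′ vw′ with pairingGraph⁻ vw′
        ... | inj₁ (v∈S , _) = ⊥-elim (false≢true (trans (sym (∉S v∈T)) v∈S))
        ... | inj₂ (w′∈S , refl) = sym (from-to w′ w′∈S)

-- Arithmetic of the counting argument

-- cross (a ∈ S) (b ∈ S) is 1 exactly when the edge ab leaves S.
cross : Bool → Bool → ℕ
cross a b = ⟦ a ∧ not b ⟧ + ⟦ b ∧ not a ⟧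

divides-gap : ∀ {D k d} → 3 ∣ D + k → 3 ∣ D + (k + d) → 3 ∣ d
divides-gap {D} {k} {d} 3∣D+k 3∣D+k+d = ∣m+n∣m⇒∣n (subst (3 ∣_) (sym (+-assoc D k d)) 3∣D+k+d) 3∣D+k

residue-two : ∀ {D k l} → 3 ∣ D + k → 3 ∣ D + l → k + l ≡ 4 → k ≡ 2
residue-two {D} {0} 3∣D+k 3∣D+l refl = ⊥-elim (from-no (3 ∣? 4) (divides-gap {D} {0} {4} 3∣D+k 3∣D+l))
residue-two {D} {1} 3∣D+k 3∣D+l refl = ⊥-elim (from-no (3 ∣? 2) (divides-gap {D} {1} {2} 3∣D+k 3∣D+l))
residue-two {D} {2} _ _ _ = refl
residue-two {D} {3} 3∣D+k 3∣D+l refl = ⊥-elim (from-no (3 ∣? 2) (divides-gap {D} {1} {2} 3∣D+l 3∣D+k))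
residue-two {D} {4} 3∣D+k 3∣D+l refl = ⊥-elim (from-no (3 ∣? 4) (divides-gap {D} {0} {4} 3∣D+l 3∣D+k))
residue-two {k = suc (suc (suc (suc (suc _))))} _ _ ()

one-of-two : ∀ a b → ⟦ a ⟧ + ⟦ b ⟧ ≡ 1 → a ≢ b
one-of-two true false _ = λ ()
one-of-two false true _ = λ ()

two-of-four : ∀ a b p q → (⟦ a ⟧ + ⟦ b ⟧) + (⟦ p ⟧ + ⟦ q ⟧) ≡ 2 →
              (a ≡ true × b ≡ true × p ≡ false × q ≡ false) ⊎
              (a ≡ false × b ≡ false × p ≡ true × q ≡ true) ⊎
              (a ≢ b × p ≢ q)
two-of-four true true false false _ = inj₁ (refl , refl , refl , refl)
two-of-four false false true true _ = inj₂ (inj₁ (refl , refl , refl , refl))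
two-of-four true false p q sum = inj₂ (inj₂ ((λ ()) , one-of-two p q (suc-injective sum)))
two-of-four false true p q sum = inj₂ (inj₂ ((λ ()) , one-of-two p q (suc-injective sum)))
two-of-four true true true _ ()
two-of-four true true false true ()
two-of-four false false false false ()
two-of-four false false false true ()
two-of-four false false true false ()

*3-floor : ∀ a b → a * 3 ≤ b * 3 + 2 → a ≤ b
*3-floor zero b _ = z≤n
*3-floor (suc a) zero (s≤s (s≤s ()))
*3-floor (suc a) (suc b) (s≤s (s≤s (s≤s a*3≤))) = s≤s (*3-floor a b a*3≤)

surplus-arith : ∀ {D ε r φ ce cf x y} → D + ε ≡ x * 3 → D + r + φ ≡ y * 3 → 3 ≤ r + ce + cf →
                x * 3 + 3 + φ ≤ y * 3 + (ε + ce) + cf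
surplus-arith {D} {ε} {r} {φ} {ce} {cf} {x} {y} D+ε≡ D+r+φ≡ 3≤cut = begin
  x * 3 + 3 + φ                   ≡⟨ cong (λ z → z + 3 + φ) D+ε≡ ⟨
  D + ε + 3 + φ                   ≤⟨ +-monoˡ-≤ φ (+-monoʳ-≤ (D + ε) 3≤cut) ⟩
  D + ε + (r + ce + cf) + φ       ≡⟨ rearrange D ε r φ ce cf ⟩
  D + r + φ + (ε + ce) + cf       ≡⟨ cong (λ z → z + (ε + ce) + cf) D+r+φ≡ ⟩
  y * 3 + (ε + ce) + cf           ∎
  where
  open ≤-Reasoning
  open +-*-Solver using (solve; _:+_; _:=_)
  rearrange : ∀ D ε r φ ce cf → D + ε + (r + ce + cf) + φ ≡ D + r + φ + (ε + ce) + cf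
  rearrange = solve 6 (λ D ε r φ ce cf → D :+ ε :+ (r :+ ce :+ cf) :+ φ := D :+ r :+ φ :+ (ε :+ ce) :+ cf) refl

ends+cross≤2 : ∀ a b → ⟦ a ⟧ + ⟦ b ⟧ + cross a b ≤ 2
ends+cross≤2 false false = z≤n
ends+cross≤2 false true = ≤-refl
ends+cross≤2 true false = ≤-refl
ends+cross≤2 true true = ≤-refl

cross≤ends : ∀ a b → cross a b ≤ ⟦ a ⟧ + ⟦ b ⟧
cross≤ends false false = z≤n
cross≤ends false true = ≤-refl
cross≤ends true false = ≤-refl
cross≤ends true true = z≤n

strict-surplus : ∀ {x y φ k cf} → x * 3 + 3 + φ ≤ y * 3 + k + cf → k ≤ 2 → cf ≤ φ → x < y
strict-surplus {x} {y} {φ} {k} {cf} key k≤2 cf≤φ = *3-floor (suc x) y (+-cancelʳ-≤ φ _ _ (begin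
  suc x * 3 + φ     ≡⟨ cong (_+ φ) (+-comm 3 (x * 3)) ⟩
  x * 3 + 3 + φ     ≤⟨ key ⟩
  y * 3 + k + cf    ≤⟨ +-mono-≤ (+-monoʳ-≤ (y * 3) k≤2) cf≤φ ⟩
  y * 3 + 2 + φ     ∎))
  where open ≤-Reasoning

avoiding-surplus : ∀ {x y} a b → x * 3 + 3 + (⟦ a ⟧ + ⟦ b ⟧) ≤ y * 3 + cross a b → x + (⟦ a ⟧ + ⟦ b ⟧) ≤ y
avoiding-surplus {x} {y} a b key = *3-floor _ y (+-cancelʳ-≤ (cross a b) _ _ (begin
  (x + φ) * 3 + cross a b          ≡⟨ trans (cong (_+ cross a b) (*-distribʳ-+ 3 x φ)) (+-assoc (x * 3) _ _) ⟩
  x * 3 + (φ * 3 + cross a b)      ≤⟨ +-monoʳ-≤ (x * 3) (φ-bound a b) ⟩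
  x * 3 + (3 + φ + 2)              ≡⟨ trans (sym (+-assoc (x * 3) (3 + φ) 2)) (cong (_+ 2) (sym (+-assoc (x * 3) 3 φ))) ⟩
  x * 3 + 3 + φ + 2                ≤⟨ +-monoˡ-≤ 2 key ⟩
  y * 3 + cross a b + 2            ≡⟨ +-right-swap (y * 3) (cross a b) 2 ⟩
  y * 3 + 2 + cross a b            ∎))
  where
  open ≤-Reasoning
  φ : ℕ
  φ = ⟦ a ⟧ + ⟦ b ⟧
  φ-bound : ∀ a b → (⟦ a ⟧ + ⟦ b ⟧) * 3 + cross a b ≤ 3 + (⟦ a ⟧ + ⟦ b ⟧) + 2
  φ-bound false false = ≤ᵇ⇒≤ _ _ _
  φ-bound false true = ≤ᵇ⇒≤ _ _ _
  φ-bound true false = ≤ᵇ⇒≤ _ _ _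
  φ-bound true true = ≤ᵇ⇒≤ _ _ _

-- The graph G − {e, f}

Proper : ∀ {n} → Graph n → Subset n → Set
Proper Γ c = ∀ u v → Γ u v ≡ true → c u ≢ c v

∁-proper : ∀ {n} {Γ : Graph n} {c} → Proper Γ c → Proper Γ (∁ c)
∁-proper proper u v Γuv = proper u v Γuv ∘ not-injective


module TwoEdgeDeletion {n} {G : Graph n} (G-sym : Symmetric G) (loopless : ∀ v → G v v ≡ false) (cubic : Cubic G)
  (3-connected : EdgeConnected 3 G)
  {e₁ e₂ f₁ f₂ : Fin n} (Ge : G e₁ e₂ ≡ true) (Gf : G f₁ f₂ ≡ true)
  (e≠f : ¬ SameEdge (e₁ , e₂) (f₁ , f₂)) where

  H : Graph n
  H = G ∖ ((e₁ , e₂) ∷ (f₁ , f₂) ∷ [])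

  E F : Graph n
  E = edge e₁ e₂
  F = edge f₁ f₂

  e₁≢e₂ : e₁ ≢ e₂
  e₁≢e₂ refl = false≢true (trans (sym (loopless e₁)) Ge)

  f₁≢f₂ : f₁ ≢ f₂
  f₁≢f₂ refl = false≢true (trans (sym (loopless f₁)) Gf)

  H-sym : Symmetric H
  H-sym x y =
    cong₂ (λ g h → g ∧ not h) (G-sym x y) (cong₂ _∨_ (edge-sym e₁ e₂ x y) (cong (_∨ false) (edge-sym f₁ f₂ x y)))

  H⊆G : ∀ x y → H x y ≡ true → G x y ≡ true
  H⊆G x y = ∧-conicalˡ (G x y) _

  H⁺ : ∀ {x y} → G x y ≡ true → E x y ≡ false → F x y ≡ false → H x y ≡ true
  H⁺ {x} {y} Gxy Exy Fxy rewrite Gxy | Exy | Fxy = refl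

  E-F-disjoint : ∀ x y → E x y ≡ true → F x y ≡ false
  E-F-disjoint x y Exy with F x y in Fxy
  ... | false = refl
  ... | true = ⊥-elim (e≠f (same (edge⁻ {a = e₁} {b = e₂} Exy) (edge⁻ {a = f₁} {b = f₂} Fxy)))
    where
    same : (x ≡ e₁ × y ≡ e₂) ⊎ (x ≡ e₂ × y ≡ e₁) → (x ≡ f₁ × y ≡ f₂) ⊎ (x ≡ f₂ × y ≡ f₁) →
           SameEdge (e₁ , e₂) (f₁ , f₂)
    same (inj₁ (refl , refl)) (inj₁ (refl , refl)) = inj₁ (refl , refl)
    same (inj₁ (refl , refl)) (inj₂ (refl , refl)) = inj₂ (refl , refl)
    same (inj₂ (refl , refl)) (inj₁ (refl , refl)) = inj₂ (refl , refl)
    same (inj₂ (refl , refl)) (inj₂ (refl , refl)) = inj₁ (refl , refl)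

  G≗H∪E∪F : ∀ x y → G x y ≡ (H ∪ᴳ E ∪ᴳ F) x y
  G≗H∪E∪F x y with E x y in Exy | F x y in Fxy
  ... | false | false = sym (trans (∨-identityʳ _) (∧-identityʳ _))
  ... | true | _ = trans (edge⊆ G-sym Ge x y Exy) (sym (∨-zeroʳ _))
  ... | false | true = trans (edge⊆ G-sym Gf x y Fxy) (sym (∨-zeroʳ _))

  arcs-G : ∀ X Y → arcs G X Y ≡ arcs H X Y + (arcs E X Y + arcs F X Y)
  arcs-G X Y = begin
    arcs G X Y                               ≡⟨ sum₂-cong (λ x y → cong (λ b → ⟦ (X x ∧ Y y) ∧ b ⟧) (G≗H∪E∪F x y)) ⟩
    arcs (H ∪ᴳ E ∪ᴳ F) X Y                   ≡⟨ arcs-∪ᴳ H (E ∪ᴳ F) X Y H-E∪F-disjoint ⟩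
    arcs H X Y + arcs (E ∪ᴳ F) X Y           ≡⟨ cong (arcs H X Y +_) (arcs-∪ᴳ E F X Y E-F-disjoint) ⟩
    arcs H X Y + (arcs E X Y + arcs F X Y)   ∎
    where
    open ≡-Reasoning
    H-E∪F-disjoint : ∀ x y → H x y ≡ true → (E ∪ᴳ F) x y ≡ false
    H-E∪F-disjoint x y Hxy = trans (sym (not-involutive _))
      (cong not (trans (cong (λ b → not (E x y ∨ b)) (sym (∨-identityʳ (F x y)))) (∧-conicalʳ (G x y) _ Hxy)))

  endsᵉ endsᶠ ends : Subset n → ℕ
  endsᵉ X = ⟦ X e₁ ⟧ + ⟦ X e₂ ⟧
  endsᶠ X = ⟦ X f₁ ⟧ + ⟦ X f₂ ⟧
  ends X = endsᵉ X + endsᶠ X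

  handshake : ∀ X → arcs H X full + ends X ≡ card X * 3
  handshake X = begin
    arcs H X full + ends X                          ≡⟨ cong (arcs H X full +_) (cong₂ _+_ (ends-of e₁≢e₂) (ends-of f₁≢f₂)) ⟨
    arcs H X full + (arcs E X full + arcs F X full) ≡⟨ arcs-G X full ⟨
    arcs G X full                                   ≡⟨ arcs-full cubic X ⟩
    card X * 3                                      ∎
    where
    open ≡-Reasoning
    ends-of : ∀ {a b} → a ≢ b → arcs (edge a b) X full ≡ ⟦ X a ⟧ + ⟦ X b ⟧
    ends-of {a} {b} a≢b =
      trans (arcs-edge a≢b X full) (cong₂ (λ p q → ⟦ p ⟧ + ⟦ q ⟧) (∧-identityʳ (X a)) (∧-identityʳ (X b)))

  cut-G : ∀ S → arcs G S (∁ S) ≡ arcs H S (∁ S) + (cross (S e₁) (S e₂) + cross (S f₁) (S f₂))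
  cut-G S =
    trans (arcs-G S (∁ S)) (cong (arcs H S (∁ S) +_) (cong₂ _+_ (arcs-edge e₁≢e₂ S (∁ S)) (arcs-edge f₁≢f₂ S (∁ S))))

  proper-balanced-arcs : ∀ {c} → Proper H c → arcs H c full ≡ arcs H (∁ c) full
  proper-balanced-arcs {c} proper = begin
    arcs H c full     ≡⟨ arcs-full-⊆ (λ x y x∈c Hxy → trans (sym (¬-not (proper x y Hxy))) x∈c) ⟩
    arcs H c (∁ c)    ≡⟨ arcs-sym H-sym c (∁ c) ⟩
    arcs H (∁ c) c    ≡⟨ arcs-full-⊆ (λ x y x∉c Hxy → trans (¬-not (proper y x (trans (H-sym y x) Hxy))) x∉c) ⟨
    arcs H (∁ c) full ∎
    where open ≡-Reasoning

  ends-∁ : ∀ X → ends X + ends (∁ X) ≡ 4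
  ends-∁ X = begin
    ends X + ends (∁ X)                                       ≡⟨ +-interchange (endsᵉ X) _ _ _ ⟩
    (endsᵉ X + endsᵉ (∁ X)) + (endsᶠ X + endsᶠ (∁ X))         ≡⟨ cong₂ _+_ (pair (X e₁) (X e₂)) (pair (X f₁) (X f₂)) ⟩
    4                                                         ∎
    where
    open ≡-Reasoning
    pair : ∀ a b → (⟦ a ⟧ + ⟦ b ⟧) + (⟦ not a ⟧ + ⟦ not b ⟧) ≡ 2
    pair false false = refl
    pair false true = refl
    pair true false = refl
    pair true true = refl

  proper-ends : ∀ {c} → Proper H c → ends c ≡ 2
  proper-ends {c} proper = residue-two {arcs H c full} (divides (card c) (handshake c))
    (divides (card (∁ c)) (trans (cong (_+ ends (∁ c)) (proper-balanced-arcs proper)) (handshake (∁ c)))) (ends-∁ c)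

  proper-ends-balanced : ∀ {c} → Proper H c → ends c ≡ ends (∁ c)
  proper-ends-balanced proper = trans (proper-ends proper) (sym (proper-ends (∁-proper proper)))

  separating⇒proper : ∀ {c} → Proper H c → c e₁ ≢ c e₂ → c f₁ ≢ c f₂ → Proper G c
  separating⇒proper {c} proper ce cf u v Guv with E u v in Euv | F u v in Fuv
  ... | false | false = proper u v (H⁺ Guv Euv Fuv)
  ... | true | _ = edge-separated {c = c} ce Euv
  ... | false | true = edge-separated {c = c} cf Fuv

  ColourClasses : Subset n → Set
  ColourClasses A = Proper H A × e₁ ∈ A × e₂ ∈ A × f₁ ∉ A × f₂ ∉ A

  colour-classes : ∀ {c} → Proper H c → ¬ Bipartite G → ∃ ColourClasses
  colour-classes {c} proper non-bipartite with two-of-four (c e₁) (c e₂) (c f₁) (c f₂) (proper-ends proper)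
  ... | inj₁ (ce₁ , ce₂ , cf₁ , cf₂) = c , proper , ce₁ , ce₂ , cf₁ , cf₂
  ... | inj₂ (inj₁ (ce₁ , ce₂ , cf₁ , cf₂)) =
    ∁ c , ∁-proper proper , cong not ce₁ , cong not ce₂ , cong not cf₁ , cong not cf₂
  ... | inj₂ (inj₂ (ce , cf)) = ⊥-elim (non-bipartite (c , separating⇒proper proper ce cf))

  module Classes {A : Subset n} (A-proper : Proper H A)
    (e₁∈A : e₁ ∈ A) (e₂∈A : e₂ ∈ A) (f₁∉A : f₁ ∉ A) (f₂∉A : f₂ ∉ A) where

    N : Subset n → Subset n
    N = Hall.neighbours H full

    ∈N⁻ : ∀ {X y} → y ∈ N X → ∃ λ x → x ∈ X × H x y ≡ true
    ∈N⁻ {X} y∈N = proj₂ (Hall.neighbours⁻ H {full} {X} y∈N)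

    ∈N⁺ : ∀ {X x y} → x ∈ X → H x y ≡ true → y ∈ N X
    ∈N⁺ {X} x∈X Hxy = Hall.neighbours⁺ H {full} {X} x∈X Hxy refl

    N⊆∁A : ∀ {X} → X ⊆ A → N X ⊆ ∁ A
    N⊆∁A X⊆A y y∈N with ∈N⁻ y∈N
    ... | x , x∈X , Hxy = trans (sym (¬-not (A-proper x y Hxy))) (X⊆A x x∈X)

    ∈A⇒∉N : ∀ {X v} → X ⊆ A → v ∈ A → v ∉ N X
    ∈A⇒∉N {X} {v} X⊆A v∈A with N X v in v∈N
    ... | false = refl
    ... | true = ⊥-elim (false≢true (trans (sym (cong not v∈A)) (N⊆∁A X⊆A v v∈N)))

    ∉A⇒∉ : ∀ {X v} → X ⊆ A → v ∉ A → v ∉ X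
    ∉A⇒∉ {X} {v} X⊆A v∉A with X v in v∈X
    ... | false = refl
    ... | true = ⊥-elim (false≢true (trans (sym v∉A) (X⊆A v v∈X)))

    endsᶠ-⊆A : ∀ {X} → X ⊆ A → endsᶠ X ≡ 0
    endsᶠ-⊆A X⊆A = cong₂ (λ p q → ⟦ p ⟧ + ⟦ q ⟧) (∉A⇒∉ X⊆A f₁∉A) (∉A⇒∉ X⊆A f₂∉A)

    endsᵉ-N : ∀ {X} → X ⊆ A → endsᵉ (N X) ≡ 0
    endsᵉ-N X⊆A = cong₂ (λ p q → ⟦ p ⟧ + ⟦ q ⟧) (∈A⇒∉N X⊆A e₁∈A) (∈A⇒∉N X⊆A e₂∈A)

    module _ {X : Subset n} (X⊆A : X ⊆ A) {s t} (s∈X : s ∈ X) (t∈A : t ∈ A) (t∉X : t ∉ X) where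

      private
        ε φ ce cf D r : ℕ
        ε = endsᵉ X
        φ = endsᶠ (N X)
        ce = cross (X e₁) (X e₂)
        cf = cross (N X f₁) (N X f₂)
        D = arcs H X full
        r = arcs H (N X) (∁ X)

        S : Subset n
        S = X ∪ N X

        handshake-X : D + ε ≡ card X * 3
        handshake-X = trans (cong (D +_) (sym ends-X)) (handshake X)
          where
          ends-X : ends X ≡ ε
          ends-X = trans (cong (ε +_) (endsᶠ-⊆A X⊆A)) (+-identityʳ ε)

        handshake-N : D + r + φ ≡ card (N X) * 3
        handshake-N = trans (cong₂ _+_ (sym arcs-N) (sym ends-N)) (handshake (N X))
          where
          ends-N : ends (N X) ≡ φ
          ends-N = cong (_+ φ) (endsᵉ-N X⊆A)
          arcs-N : arcs H (N X) full ≡ D + r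
          arcs-N = trans (arcs-split H (N X) full X)
                         (cong (_+ r) (trans (arcs-sym H-sym (N X) X) (sym (arcs-full-⊆ {Γ = H} {X} {N X} λ x y → ∈N⁺ {X}))))

        -- An H-arc leaving X ∪ N X cannot start in X, since every H-neighbour of X lies in N X.
        cut-H : arcs H S (∁ S) ≤ r
        cut-H = arcs-mono {Γ = H} {H} {S} {∁ S} {N X} {∁ X} pointwise
          where
          pointwise : ∀ x y → (S x ∧ not (S y)) ∧ H x y ≡ true → (N X x ∧ not (X y)) ∧ H x y ≡ true
          pointwise x y xy∈ with S x in x∈S | S y in y∈S | H x y in Hxy
          ... | true | false | true with X x in x∈X
          ... | true = ⊥-elim (false≢true (trans (sym (∨-conicalʳ (X y) _ y∈S)) (∈N⁺ {X} x∈X Hxy)))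
          ... | false rewrite x∈S | ∨-conicalˡ (X y) _ y∈S = refl

        3≤cut : 3 ≤ r + ce + cf
        3≤cut = begin
          3                                                   ≤⟨ cut-bound 3-connected S (∨-introˡ _ s∈X) t∉S ⟩
          arcs G S (∁ S)                                      ≡⟨ cut-G S ⟩
          arcs H S (∁ S) + (cross (S e₁) (S e₂) + cross (S f₁) (S f₂))
            ≡⟨ cong (arcs H S (∁ S) +_) (cong₂ _+_ (cong₂ cross (S-e e₁∈A) (S-e e₂∈A)) (cong₂ cross (S-f f₁∉A) (S-f f₂∉A))) ⟩
          arcs H S (∁ S) + (ce + cf)                          ≤⟨ +-monoˡ-≤ _ cut-H ⟩
          r + (ce + cf)                                       ≡⟨ +-assoc r ce cf ⟨
          r + ce + cf                                         ∎
          where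
          open ≤-Reasoning
          S-e : ∀ {v} → v ∈ A → S v ≡ X v
          S-e v∈A = trans (cong (_ ∨_) (∈A⇒∉N X⊆A v∈A)) (∨-identityʳ _)
          S-f : ∀ {v} → v ∉ A → S v ≡ N X v
          S-f {v} v∉A = cong (_∨ N X v) (∉A⇒∉ X⊆A v∉A)
          t∉S : t ∉ S
          t∉S = trans (S-e t∈A) t∉X

        key : card X * 3 + 3 + φ ≤ card (N X) * 3 + (ε + ce) + cf
        key = surplus-arith {D} {ε} {r} {φ} {ce} {cf} {card X} {card (N X)} handshake-X handshake-N 3≤cut

      surplus : card X < card (N X)
      surplus = strict-surplus key (ends+cross≤2 (X e₁) (X e₂)) (cross≤ends (N X f₁) (N X f₂))

      surplus-avoiding : e₁ ∉ X → e₂ ∉ X → card X + endsᶠ (N X) ≤ card (N X)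
      surplus-avoiding e₁∉X e₂∉X =
        avoiding-surplus {card X} {card (N X)} (N X f₁) (N X f₂) (subst (λ k → card X * 3 + 3 + φ ≤ k + cf) k≡ key)
        where
        k≡ : card (N X) * 3 + (ε + ce) ≡ card (N X) * 3
        k≡ rewrite e₁∉X | e₂∉X = +-identityʳ _

    classes-balanced : card A ≡ card (∁ A)
    classes-balanced = *-cancelʳ-≡ _ _ 3 (begin
      card A * 3                   ≡⟨ handshake A ⟨
      arcs H A full + ends A       ≡⟨ cong₂ _+_ (proper-balanced-arcs A-proper) (proper-ends-balanced A-proper) ⟩
      arcs H (∁ A) full + ends (∁ A) ≡⟨ handshake (∁ A) ⟩
      card (∁ A) * 3               ∎)
      where open ≡-Reasoning

    module _ {K : Subset n} (surplus-K : ∀ X → X ⊆ A ─ K → 0 < card X → card X + card (N X ∩ K) ≤ card (N X)) where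

      hall-condition : Hall.HallCondition H (A ─ K) (∁ A ─ K)
      hall-condition X X⊆ with 0 <? card X
      ... | no |X|≯0 = ≤-trans (≮⇒≥ |X|≯0) z≤n
      ... | yes 0<|X| = +-cancelˡ-≤ (card (N X ∩ K)) _ _ (begin
        card (N X ∩ K) + card X        ≡⟨ +-comm (card (N X ∩ K)) _ ⟩
        card X + card (N X ∩ K)        ≤⟨ surplus-K X X⊆ 0<|X| ⟩
        card (N X)                     ≡⟨ card-split (N X) K ⟩
        card (N X ∩ K) + card (N X ─ K) ≤⟨ +-monoʳ-≤ _ (card-mono N─K⊆) ⟩
        card (N X ∩ K) + card (Hall.neighbours H (∁ A ─ K) X) ∎)
        where
        open ≤-Reasoning
        N─K⊆ : N X ─ K ⊆ Hall.neighbours H (∁ A ─ K) X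
        N─K⊆ y y∈ with ∈─⁻ (N X) K y∈
        ... | y∈N , y∉K with ∈N⁻ {X} y∈N
        ... | x , x∈X , Hxy = Hall.neighbours⁺ H {∁ A ─ K} {X} x∈X Hxy
          (∈─⁺ (∁ A) K (N⊆∁A (λ x → proj₁ ∘ ∈─⁻ A K ∘ X⊆ x) y y∈N) y∉K)

      matching-extending : ∀ {Γ P} → Symmetric Γ → (∀ x y → H x y ≡ true → Γ x y ≡ true) →
                           PerfectMatchingOn Γ K P → card (A ∩ K) ≡ card (∁ A ∩ K) →
                           Σ (Graph n) λ M → PerfectMatching Γ M × (∀ x y → P x y ≡ true → M x y ≡ true)
      matching-extending {Γ} {P} Γ-sym H⊆Γ matched-K balanced-K =
        P ∪ᴳ pairingGraph Γ-sym disjoint pairing ,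
        perfectMatching covers (∪-perfectMatchingOn K-disjoint matched-K (pairing-perfectMatchingOn Γ-sym disjoint pairing)) ,
        (λ x y → ∨-introˡ _)
        where
        open ≡-Reasoning
        |A─K|≡|∁A─K| : card (A ─ K) ≡ card (∁ A ─ K)
        |A─K|≡|∁A─K| = +-cancelˡ-≡ (card (A ∩ K)) _ _ (begin
          card (A ∩ K) + card (A ─ K)     ≡⟨ card-split A K ⟨
          card A                          ≡⟨ classes-balanced ⟩
          card (∁ A)                      ≡⟨ card-split (∁ A) K ⟩
          card (∁ A ∩ K) + card (∁ A ─ K) ≡⟨ cong (_+ card (∁ A ─ K)) balanced-K ⟨
          card (A ∩ K) + card (∁ A ─ K)   ∎)

        pairing : Hall.Pairing Γ (A ─ K) (∁ A ─ K)
        pairing = pairing-⊆ H⊆Γ (Hall.hall H |A─K|≡|∁A─K| hall-condition)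

        disjoint : ∀ v → v ∈ A ─ K → v ∉ ∁ A ─ K
        disjoint v v∈ with A v | K v
        ... | true | _ = refl
        ... | false | _ = ⊥-elim (false≢true v∈)

        K-disjoint : ∀ v → v ∈ K → v ∉ (A ─ K) ∪ (∁ A ─ K)
        K-disjoint v v∈K rewrite v∈K = cong₂ _∨_ (∧-zeroʳ (A v)) (∧-zeroʳ (not (A v)))

        covers : ∀ v → v ∈ K ∪ ((A ─ K) ∪ (∁ A ─ K))
        covers v with K v | A v
        ... | true | _ = refl
        ... | false | true = refl
        ... | false | false = refl

    ⊆─⇒∉ : ∀ {X Y K : Subset n} {v} → X ⊆ Y ─ K → v ∈ K → v ∉ X
    ⊆─⇒∉ {X} {Y} {K} {v} X⊆ v∈K with X v in v∈X
    ... | false = refl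
    ... | true = ⊥-elim (false≢true (trans (sym (proj₂ (∈─⁻ Y K (X⊆ v v∈X)))) v∈K))

    H-edge-matching : ∀ {a b} → a ∈ A → H a b ≡ true → Σ (Graph n) λ M → PerfectMatching H M × M a b ≡ true
    H-edge-matching {a} {b} a∈A Hab =
      let M , perfect , edge⊆M = matching-extending surplus-K H-sym (λ _ _ → id) (edge-perfectMatchingOn H-sym a≢b Hab) balanced
      in M , perfect , edge⊆M a b (edge-self a b)
      where
      K : Subset n
      K = ⁅ a ⁆ ∪ ⁅ b ⁆
      b∉A : b ∉ A
      b∉A = trans (¬-not (A-proper a b Hab ∘ sym)) (cong not a∈A)
      a≢b : a ≢ b
      a≢b a≡b = false≢true (trans (sym b∉A) (subst (_∈ A) a≡b a∈A))

      balanced : card (A ∩ K) ≡ card (∁ A ∩ K)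
      balanced rewrite card-∩⁅⁆∪⁅⁆ A a≢b | card-∩⁅⁆∪⁅⁆ (∁ A) a≢b | a∈A | b∉A = refl

      surplus-K : ∀ X → X ⊆ A ─ K → 0 < card X → card X + card (N X ∩ K) ≤ card (N X)
      surplus-K X X⊆ 0<|X| = begin
        card X + card (N X ∩ K)        ≡⟨ cong (card X +_) (card-∩⁅⁆∪⁅⁆ (N X) a≢b) ⟩
        card X + (⟦ N X a ⟧ + ⟦ N X b ⟧) ≡⟨ cong (λ p → card X + (⟦ p ⟧ + ⟦ N X b ⟧)) (∈A⇒∉N X⊆A a∈A) ⟩
        card X + ⟦ N X b ⟧              ≤⟨ +-monoʳ-≤ (card X) (⟦⟧≤1 (N X b)) ⟩
        card X + 1                      ≡⟨ +-comm (card X) 1 ⟩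
        suc (card X)                    ≤⟨ surplus X⊆A (proj₂ (card>0⇒∃∈ {X = X} 0<|X|)) a∈A a∉X ⟩
        card (N X)                      ∎
        where
        open ≤-Reasoning
        X⊆A : X ⊆ A
        X⊆A x = proj₁ ∘ ∈─⁻ A K ∘ X⊆ x
        a∉X : a ∉ X
        a∉X = ⊆─⇒∉ {X} {A} {K} X⊆ (∨-introˡ _ (a∈⁅a⁆ a))

    private
      Kᵉ Kᶠ Kᵉᶠ : Subset n
      Kᵉ = ⁅ e₁ ⁆ ∪ ⁅ e₂ ⁆
      Kᶠ = ⁅ f₁ ⁆ ∪ ⁅ f₂ ⁆
      Kᵉᶠ = Kᵉ ∪ Kᶠ

      Kᵉ⊆A : Kᵉ ⊆ A
      Kᵉ⊆A v v∈ with ∨-true {⁅ e₁ ⁆ v} v∈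
      ... | inj₁ v∈e₁ = subst (_∈ A) (sym (∈⁅⁆⇒≡ v∈e₁)) e₁∈A
      ... | inj₂ v∈e₂ = subst (_∈ A) (sym (∈⁅⁆⇒≡ v∈e₂)) e₂∈A

      Kᶠ⊆∁A : Kᶠ ⊆ ∁ A
      Kᶠ⊆∁A v v∈ with ∨-true {⁅ f₁ ⁆ v} v∈
      ... | inj₁ v∈f₁ = cong not (subst (_∉ A) (sym (∈⁅⁆⇒≡ v∈f₁)) f₁∉A)
      ... | inj₂ v∈f₂ = cong not (subst (_∉ A) (sym (∈⁅⁆⇒≡ v∈f₂)) f₂∉A)

      Kᵉ-Kᶠ-disjoint : ∀ v → v ∈ Kᵉ → v ∉ Kᶠ
      Kᵉ-Kᶠ-disjoint v v∈ with Kᶠ v in v∈Kᶠ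
      ... | false = refl
      ... | true = ⊥-elim (false≢true (trans (sym (cong not (Kᵉ⊆A v v∈))) (Kᶠ⊆∁A v v∈Kᶠ)))

      card-∩Kᵉᶠ : ∀ Y → card (Y ∩ Kᵉᶠ) ≡ ends Y
      card-∩Kᵉᶠ Y = trans (card-∩∪ Y Kᵉ Kᶠ Kᵉ-Kᶠ-disjoint) (cong₂ _+_ (card-∩⁅⁆∪⁅⁆ Y e₁≢e₂) (card-∩⁅⁆∪⁅⁆ Y f₁≢f₂))

    E∪F-matching : Σ (Graph n) λ M → PerfectMatching G M × (∀ x y → (E ∪ᴳ F) x y ≡ true → M x y ≡ true)
    E∪F-matching = matching-extending surplus-K G-sym H⊆G matched balanced
      where
      matched : PerfectMatchingOn G Kᵉᶠ (E ∪ᴳ F)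
      matched = ∪-perfectMatchingOn Kᵉ-Kᶠ-disjoint
        (edge-perfectMatchingOn G-sym e₁≢e₂ Ge) (edge-perfectMatchingOn G-sym f₁≢f₂ Gf)

      balanced : card (A ∩ Kᵉᶠ) ≡ card (∁ A ∩ Kᵉᶠ)
      balanced = trans (card-∩Kᵉᶠ A) (trans (proper-ends-balanced A-proper) (sym (card-∩Kᵉᶠ (∁ A))))

      surplus-K : ∀ X → X ⊆ A ─ Kᵉᶠ → 0 < card X → card X + card (N X ∩ Kᵉᶠ) ≤ card (N X)
      surplus-K X X⊆ 0<|X| = begin
        card X + card (N X ∩ Kᵉᶠ)              ≡⟨ cong (card X +_) (card-∩Kᵉᶠ (N X)) ⟩
        card X + ends (N X)                     ≡⟨ cong (λ p → card X + (p + endsᶠ (N X))) (endsᵉ-N X⊆A) ⟩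
        card X + endsᶠ (N X)                    ≤⟨ surplus-avoiding X⊆A (proj₂ (card>0⇒∃∈ {X = X} 0<|X|)) e₁∈A e₁∉X e₁∉X e₂∉X ⟩
        card (N X)                              ∎
        where
        open ≤-Reasoning
        X⊆A : X ⊆ A
        X⊆A x = proj₁ ∘ ∈─⁻ A Kᵉᶠ ∘ X⊆ x
        e₁∉X : e₁ ∉ X
        e₁∉X = ⊆─⇒∉ {X} {A} {Kᵉᶠ} X⊆ (∨-introˡ _ (∨-introˡ _ (a∈⁅a⁆ e₁)))
        e₂∉X : e₂ ∉ X
        e₂∉X = ⊆─⇒∉ {X} {A} {Kᵉᶠ} X⊆ (∨-introˡ _ (∨-introʳ (⁅ e₁ ⁆ e₂) (a∈⁅a⁆ e₂)))

    H-matchingCovered : MatchingCovered H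
    H-matchingCovered = 3-connected ((e₁ , e₂) ∷ (f₁ , f₂) ∷ []) ≤-refl , covered
      where
      covered : ∀ u v → H u v ≡ true → Σ (Graph n) λ M → PerfectMatching H M × M u v ≡ true
      covered u v Huv with A u in u∈A
      ... | true = H-edge-matching u∈A Huv
      ... | false =
        let M , perfect@(_ , M-sym , _) , Mvu = H-edge-matching v∈A (trans (H-sym v u) Huv)
        in M , perfect , trans (M-sym u v) Mvu
        where
        v∈A : v ∈ A
        v∈A = trans (¬-not (A-proper u v Huv ∘ sym)) (cong not u∈A)

    G-matchingCovered : MatchingCovered G
    G-matchingCovered = (λ u v → walk-⊆ (λ x y → ∧-conicalˡ (G x y) _) (3-connected [] (s≤s z≤n) u v)) , covered
      where
      covered : ∀ u v → G u v ≡ true → Σ (Graph n) λ M → PerfectMatching G M × M u v ≡ true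
      covered u v Guv with E u v in Euv | F u v in Fuv
      ... | false | false =
        let M , perfect , Muv = proj₂ H-matchingCovered u v (H⁺ Guv Euv Fuv) in M , perfectMatching-⊆ H⊆G perfect , Muv
      ... | true | _ = let M , perfect , E∪F⊆M = E∪F-matching in M , perfect , E∪F⊆M u v (∨-introˡ _ Euv)
      ... | false | true = let M , perfect , E∪F⊆M = E∪F-matching in M , perfect , E∪F⊆M u v (∨-introʳ (E u v) Fuv)

  matchingCovered : ∀ {c} → Proper H c → ¬ Bipartite G → MatchingCovered H × MatchingCovered G
  matchingCovered c-proper non-bipartite with colour-classes c-proper non-bipartite
  ... | _ , A-proper , e₁∈A , e₂∈A , f₁∉A , f₂∉A = H-matchingCovered , G-matchingCovered
    where open Classes A-proper e₁∈A e₂∈A f₁∉A f₂∉A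

proposition2p7 : ∀ {n} (G : Graph n) → IsSimple G → Cubic G → EdgeConnected 3 G →
    ¬ Bipartite G →
    ∀ e f → IsEdge G e → IsEdge G f → ¬ SameEdge e f →
    Bipartite (G ∖ (e ∷ f ∷ [])) →
    MatchingCovered (G ∖ (e ∷ f ∷ [])) × NearBipartite G
proposition2p7 G (G-sym , loopless) cubic 3-connected non-bipartite (e₁ , e₂) (f₁ , f₂) Ge Gf e≠f (c , c-proper) =
  proj₁ covered , non-bipartite , proj₂ covered , (e₁ , e₂) , (f₁ , f₂) , Ge , Gf , e≠f , (c , c-proper) , proj₁ covered
  where
  open TwoEdgeDeletion G-sym loopless cubic 3-connected Ge Gf e≠f
  covered : MatchingCovered H × MatchingCovered G
  covered = matchingCovered c-proper non-bipartite
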